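{- For every fixed positive integer $m$, $$\lim_{n\to\infty}\frac{\alpha(m,n+2)}{\alpha(m,n)}=\alpha(m,1)^2=\binom{2\lfloor\frac{m+1}{2}\rfloor}{\lfloor\frac{m+1}{2}\rfloor}^2.$$
   Context: For positive integers $m,n$, let $A(m,n)$ be the set of all $m\times n$ matrices with every entry in $\{1,-1\}$ such that every row sum and every column sum has absolute value at most $1$, and let $\alpha(m,n)=|A(m,n)|$. -}

module Defs where

open import Data.Nat using (ℕ; zero; suc; _≤ᵇ_)
open import Data.Bool using (Bool; _∧_; true)
open import Data.Integer as ℤ using (ℤ; ∣_∣; _◃_)
open import Data.Sign using (Sign)
open import Data.List using (List; []; _∷_; length; filterᵇ; concatMap; map)
open import Data.Vec as V using (Vec; []; _∷_; transpose)

-- entries of the matrices: a sign s stands for the integer s·1 ∈ {1,-1}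
signs : List Sign
signs = Sign.+ ∷ Sign.- ∷ []

val : Sign → ℤ
val s = s ◃ 1

-- all vectors of length n with entries from a list (duplicate-free if the list is)
allVecs : {A : Set} → List A → (n : ℕ) → List (Vec A n)
allVecs xs zero = [] ∷ []
allVecs xs (suc n) = concatMap (λ x → map (x ∷_) (allVecs xs n)) xs

-- m × n sign matrices, as m rows of length n
Mat : ℕ → ℕ → Set
Mat m n = Vec (Vec Sign n) m

allMats : (m n : ℕ) → List (Mat m n)
allMats m n = allVecs (allVecs signs n) m

lineSum : {k : ℕ} → Vec Sign k → ℤ
lineSum v = V.foldr _ ℤ._+_ ℤ.0ℤ (V.map val v)

smallSum : {k : ℕ} → Vec Sign k → Bool
smallSum v = ∣ lineSum v ∣ ≤ᵇ 1

allᵇ : {A : Set} {k : ℕ} → (A → Bool) → Vec A k → Bool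
allᵇ p v = V.foldr _ _∧_ true (V.map p v)

inA : {m n : ℕ} → Mat m n → Bool
inA M = allᵇ smallSum M ∧ allᵇ smallSum (transpose M)

α : ℕ → ℕ → ℕ
α m n = length (filterᵇ inA (allMats m n))

-- Reading a matrix column by column, α(m, n) counts the walks of n steps in ℤ^m that start at 0,
-- take their steps from the c = α(m, 1) columns with sum in {-1, 0, 1}, and end in the box
-- {-1, 0, 1}^m. Every step changes the parity of all coordinates, so a walk of length 2k ends
-- in the box only at 0 and a walk of length 2k + 1 only in T = {±1}^m. Since the step set is
-- symmetric, α(m, 2k) = a k is the number of pairs of k-step walks from 0 with a common endpoint,
-- and α(m, 2k + 1) = b k counts the meeting pairs of walks from the first step and from T.
-- Such collision counts are log-convex by Cauchy–Schwarz, grow by a factor at most c² per step,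
-- and are at least c^(2k) / (2k + 3)^m because the endpoints lie in a box of side 2k + 3; hence
-- their successive ratios increase to c². The same limit follows for b, which is squeezed
-- through the collision count w k = a (k + 1) + 2 b k + d k of the union of both starting sets.
-- Finally, the columns of length m with sum in {-1, 0, 1} are counted by a binomial coefficient.

module Submission where

open import Data.Bool using (Bool; true; false; if_then_else_; _∧_)
open import Data.Empty using (⊥-elim)
open import Data.Integer as ℤ using (ℤ; 0ℤ; -[1+_]; _⊖_; ∣_∣)
import Data.Integer.Properties as ℤ
open import Data.List using (List; []; _∷_; _++_; map; concatMap; length; filterᵇ; [_])
import Data.List.Properties as List
open import Data.List.Relation.Unary.All as All using (All; []; _∷_)
import Data.List.Relation.Unary.All.Properties as All
open import Data.Nat
open import Data.Nat.Combinatorics using (_C_; nCk+nC[k+1]≡[n+1]C[k+1])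
open import Data.Nat.DivMod using (_/_; m*n/n≡m; m/n≡1+[m∸n]/n; /-congˡ)
open import Data.Nat.Properties
open import Data.Nat.Tactic.RingSolver using (solve-∀)
open import Data.Parity.Base using (Parity; 0ℙ; 1ℙ; _⁻¹)
import Data.Parity.Properties as ℙ
open import Data.Product using (Σ; ∃; _,_; _×_)
open import Data.Rational as ℚ using (ℚ; 0ℚ; mkℚ; toℚᵘ)
import Data.Rational.Properties as ℚ
open import Data.Rational.Unnormalised as ℚᵘ using (mkℚᵘ)
import Data.Rational.Unnormalised.Properties as ℚᵘ
open import Data.Sign as Sign using (Sign)
open import Data.Sum using (_⊎_; inj₁; inj₂)
open import Data.Vec as Vec using (Vec; []; _∷_; zipWith; replicate; transpose)
import Data.Vec.Properties as Vec
import Data.Vec.Relation.Unary.All as Allᵛ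
open import Function using (case_of_)
open import Relation.Binary.Definitions using (DecidableEquality)
open import Relation.Binary.PropositionalEquality hiding ([_])
open import Relation.Nullary using (¬_; yes; no; Dec)
open import Defs

private
  variable
    A B : Set
    k m n : ℕ

-- Sums over lists

∑ : List A → (A → ℕ) → ℕ
∑ [] f = 0
∑ (x ∷ xs) f = f x + ∑ xs f

∑-cong : (xs : List A) {f g : A → ℕ} → (∀ x → f x ≡ g x) → ∑ xs f ≡ ∑ xs g
∑-cong [] e = refl
∑-cong (x ∷ xs) e = cong₂ _+_ (e x) (∑-cong xs e)

∑-congᴬ : {P : A → Set} (xs : List A) {f g : A → ℕ} → All P xs → (∀ x → P x → f x ≡ g x) → ∑ xs f ≡ ∑ xs g
∑-congᴬ [] [] e = refl
∑-congᴬ (x ∷ xs) (px ∷ pxs) e = cong₂ _+_ (e x px) (∑-congᴬ xs pxs e)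

∑-mono-≤ : (xs : List A) {f g : A → ℕ} → (∀ x → f x ≤ g x) → ∑ xs f ≤ ∑ xs g
∑-mono-≤ [] e = z≤n
∑-mono-≤ (x ∷ xs) e = +-mono-≤ (e x) (∑-mono-≤ xs e)

∑-++ : (xs ys : List A) (f : A → ℕ) → ∑ (xs ++ ys) f ≡ ∑ xs f + ∑ ys f
∑-++ [] ys f = refl
∑-++ (x ∷ xs) ys f = trans (cong (f x +_) (∑-++ xs ys f)) (sym (+-assoc (f x) _ _))

∑-distrib-+ : (xs : List A) (f g : A → ℕ) → ∑ xs (λ x → f x + g x) ≡ ∑ xs f + ∑ xs g
∑-distrib-+ [] f g = refl
∑-distrib-+ (x ∷ xs) f g rewrite ∑-distrib-+ xs f g = +-+-swap (f x) (g x) (∑ xs f) (∑ xs g)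
  where +-+-swap : ∀ a b c d → (a + b) + (c + d) ≡ (a + c) + (b + d)
        +-+-swap = solve-∀

*-distribˡ-∑ : (xs : List A) (k : ℕ) (f : A → ℕ) → ∑ xs (λ x → k * f x) ≡ k * ∑ xs f
*-distribˡ-∑ [] k f = sym (*-zeroʳ k)
*-distribˡ-∑ (x ∷ xs) k f = trans (cong (k * f x +_) (*-distribˡ-∑ xs k f)) (sym (*-distribˡ-+ k (f x) _))

∑-const : (xs : List A) (k : ℕ) → ∑ xs (λ _ → k) ≡ length xs * k
∑-const [] k = refl
∑-const (x ∷ xs) k = cong (k +_) (∑-const xs k)

∑-1 : (xs : List A) → ∑ xs (λ _ → 1) ≡ length xs
∑-1 xs = trans (∑-const xs 1) (*-identityʳ (length xs))

∑-0 : (xs : List A) → ∑ xs (λ _ → 0) ≡ 0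
∑-0 xs = trans (∑-const xs 0) (*-zeroʳ (length xs))

∑-swap : (xs : List A) (ys : List B) (g : A → B → ℕ) →
         ∑ xs (λ x → ∑ ys (g x)) ≡ ∑ ys (λ y → ∑ xs (λ x → g x y))
∑-swap [] ys g = sym (∑-0 ys)
∑-swap (x ∷ xs) ys g =
  trans (cong (∑ ys (g x) +_) (∑-swap xs ys g)) (sym (∑-distrib-+ ys (g x) (λ y → ∑ xs (λ x → g x y))))

∑-map : (xs : List A) (h : A → B) (f : B → ℕ) → ∑ (map h xs) f ≡ ∑ xs (λ x → f (h x))
∑-map [] h f = refl
∑-map (x ∷ xs) h f = cong (f (h x) +_) (∑-map xs h f)

∑-concatMap : (xs : List A) (h : A → List B) (f : B → ℕ) →
              ∑ (concatMap h xs) f ≡ ∑ xs (λ x → ∑ (h x) f)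
∑-concatMap [] h f = refl
∑-concatMap (x ∷ xs) h f = trans (∑-++ (h x) (concatMap h xs) f) (cong (∑ (h x) f +_) (∑-concatMap xs h f))

length-concatMap : (h : A → List B) (xs : List A) → length (concatMap h xs) ≡ ∑ xs (λ x → length (h x))
length-concatMap h xs = trans (sym (∑-1 (concatMap h xs))) (trans (∑-concatMap xs h _) (∑-cong xs (λ x → ∑-1 (h x))))

∑-product : {D : Set} (f : A → B → D) (xs : List A) (ys : List B) (h : D → ℕ) →
            ∑ (concatMap (λ a → map (f a) ys) xs) h ≡ ∑ xs (λ a → ∑ ys (λ b → h (f a b)))
∑-product f xs ys h = trans (∑-concatMap xs _ h) (∑-cong xs (λ a → ∑-map ys (f a) h))

𝟙 : Bool → ℕ
𝟙 true = 1
𝟙 false = 0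

𝟙-∧ : ∀ a b → 𝟙 (a ∧ b) ≡ 𝟙 a * 𝟙 b
𝟙-∧ true b = sym (+-identityʳ (𝟙 b))
𝟙-∧ false b = refl

∑-filterᵇ : (p : A → Bool) (xs : List A) (f : A → ℕ) → ∑ (filterᵇ p xs) f ≡ ∑ xs (λ a → 𝟙 (p a) * f a)
∑-filterᵇ p [] f = refl
∑-filterᵇ p (x ∷ xs) f with p x
... | true = cong₂ _+_ (sym (+-identityʳ (f x))) (∑-filterᵇ p xs f)
... | false = ∑-filterᵇ p xs f

length-filterᵇ : (p : A → Bool) (xs : List A) → length (filterᵇ p xs) ≡ ∑ xs (λ x → 𝟙 (p x))
length-filterᵇ p xs = trans (sym (∑-1 (filterᵇ p xs))) (trans (∑-filterᵇ p xs _) (∑-cong xs (λ x → *-identityʳ _)))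

copies : ℕ → List A → List A
copies zero xs = []
copies (suc a) xs = xs ++ copies a xs

∑-copies : (a : ℕ) (xs : List A) (f : A → ℕ) → ∑ (copies a xs) f ≡ a * ∑ xs f
∑-copies zero xs f = refl
∑-copies (suc a) xs f = trans (∑-++ xs (copies a xs) f) (cong (∑ xs f +_) (∑-copies a xs f))

-- Coincidences of multisets

-- Lists are multisets; ⟪ X , Y ⟫ is the number of pairs (x , y) ∈ X × Y with x ≡ y,
-- i.e. the inner product of the multiplicity functions of X and Y.
module Coincidences {A : Set} (_≟_ : DecidableEquality A) where

  δ : A → A → ℕ
  δ x y with x ≟ y
  ... | yes _ = 1
  ... | no _ = 0

  δ-refl : ∀ x → δ x x ≡ 1
  δ-refl x with x ≟ x
  ... | yes _ = refl
  ... | no x≢x = ⊥-elim (x≢x refl)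

  δ-≡ : ∀ {x y} → x ≡ y → δ x y ≡ 1
  δ-≡ refl = δ-refl _

  δ-≢ : ∀ {x y} → ¬ x ≡ y → δ x y ≡ 0
  δ-≢ {x} {y} x≢y with x ≟ y
  ... | yes x≡y = ⊥-elim (x≢y x≡y)
  ... | no _ = refl

  δ-cong : ∀ {x y x′ y′} → (x ≡ y → x′ ≡ y′) → (x′ ≡ y′ → x ≡ y) → δ x y ≡ δ x′ y′
  δ-cong {x} {y} {x′} {y′} to from with x ≟ y | x′ ≟ y′
  ... | yes _ | yes _ = refl
  ... | no _ | no _ = refl
  ... | yes x≡y | no x′≢y′ = ⊥-elim (x′≢y′ (to x≡y))
  ... | no x≢y | yes x′≡y′ = ⊥-elim (x≢y (from x′≡y′))

  δ-sym : ∀ x y → δ x y ≡ δ y x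
  δ-sym x y = δ-cong sym sym

  count : A → List A → ℕ
  count x Y = ∑ Y (δ x)

  ⟪_,_⟫ : List A → List A → ℕ
  ⟪ X , Y ⟫ = ∑ X (λ x → count x Y)

  ⟪⟫-sym : ∀ X Y → ⟪ X , Y ⟫ ≡ ⟪ Y , X ⟫
  ⟪⟫-sym X Y = trans (∑-swap X Y δ) (∑-cong Y (λ y → ∑-cong X (λ x → δ-sym x y)))

  ⟪⟫-++ˡ : ∀ X X′ Y → ⟪ X ++ X′ , Y ⟫ ≡ ⟪ X , Y ⟫ + ⟪ X′ , Y ⟫
  ⟪⟫-++ˡ X X′ Y = ∑-++ X X′ _

  ⟪⟫-++ʳ : ∀ X Y Y′ → ⟪ X , Y ++ Y′ ⟫ ≡ ⟪ X , Y ⟫ + ⟪ X , Y′ ⟫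
  ⟪⟫-++ʳ X Y Y′ = trans (∑-cong X (λ x → ∑-++ Y Y′ (δ x))) (∑-distrib-+ X _ _)

  ⟪++,++⟫ : ∀ X Y → ⟪ X ++ Y , X ++ Y ⟫ ≡ ⟪ X , X ⟫ + 2 * ⟪ X , Y ⟫ + ⟪ Y , Y ⟫
  ⟪++,++⟫ X Y = begin
    ⟪ X ++ Y , X ++ Y ⟫                               ≡⟨ ⟪⟫-++ˡ X Y (X ++ Y) ⟩
    ⟪ X , X ++ Y ⟫ + ⟪ Y , X ++ Y ⟫                   ≡⟨ cong₂ _+_ (⟪⟫-++ʳ X X Y) (⟪⟫-++ʳ Y X Y) ⟩
    (⟪ X , X ⟫ + ⟪ X , Y ⟫) + (⟪ Y , X ⟫ + ⟪ Y , Y ⟫) ≡⟨ cong (λ t → (⟪ X , X ⟫ + ⟪ X , Y ⟫) + (t + ⟪ Y , Y ⟫)) (⟪⟫-sym Y X) ⟩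
    (⟪ X , X ⟫ + ⟪ X , Y ⟫) + (⟪ X , Y ⟫ + ⟪ Y , Y ⟫) ≡⟨ regroup ⟪ X , X ⟫ ⟪ X , Y ⟫ ⟪ Y , Y ⟫ ⟩
    ⟪ X , X ⟫ + 2 * ⟪ X , Y ⟫ + ⟪ Y , Y ⟫             ∎
    where open ≡-Reasoning
          regroup : ∀ a b d → (a + b) + (b + d) ≡ a + 2 * b + d
          regroup = solve-∀

  ⟪⟫-copies : ∀ a b X Y → ⟪ copies a X , copies b Y ⟫ ≡ a * (b * ⟪ X , Y ⟫)
  ⟪⟫-copies a b X Y =
    trans (∑-copies a X _) (cong (a *_) (trans (∑-cong X (λ x → ∑-copies b Y (δ x))) (*-distribˡ-∑ X b _)))

  ⟪⟫-congʳ : ∀ X Y Y′ → (∀ z → count z Y ≡ count z Y′) → ⟪ X , Y ⟫ ≡ ⟪ X , Y′ ⟫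
  ⟪⟫-congʳ X Y Y′ e = ∑-cong X e

  ⟪⟫-congˡ : ∀ Y Y′ X → (∀ z → count z Y ≡ count z Y′) → ⟪ Y , X ⟫ ≡ ⟪ Y′ , X ⟫
  ⟪⟫-congˡ Y Y′ X e = trans (⟪⟫-sym Y X) (trans (⟪⟫-congʳ X Y Y′ e) (⟪⟫-sym X Y′))

  extract : ∀ x Y → 1 ≤ count x Y → ∃ λ Y′ → ∀ z → count z Y ≡ count z (x ∷ Y′)
  extract x (y ∷ Y) x∈Y with x ≟ y
  ... | yes refl = Y , (λ z → refl)
  ... | no _ with extract x Y x∈Y
  ...   | Y′ , e = y ∷ Y′ , λ z → trans (cong (δ z y +_) (e z)) (+-exchange (δ z y) (δ z x) (count z Y′))
    where +-exchange : ∀ a b c → a + (b + c) ≡ b + (a + c)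
          +-exchange = solve-∀

  ⟪∷,∷⟫ : ∀ x X Y → ⟪ x ∷ X , x ∷ Y ⟫ ≡ 1 + count x Y + count x X + ⟪ X , Y ⟫
  ⟪∷,∷⟫ x X Y = begin
    (δ x x + count x Y) + ∑ X (λ x′ → δ x′ x + count x′ Y)
      ≡⟨ cong₂ _+_ (cong (_+ count x Y) (δ-refl x)) (∑-distrib-+ X (λ x′ → δ x′ x) (λ x′ → count x′ Y)) ⟩
    (1 + count x Y) + (∑ X (λ x′ → δ x′ x) + ⟪ X , Y ⟫)
      ≡⟨ cong (λ t → (1 + count x Y) + (t + ⟪ X , Y ⟫)) (∑-cong X (λ x′ → δ-sym x′ x)) ⟩
    (1 + count x Y) + (count x X + ⟪ X , Y ⟫)
      ≡⟨ sym (+-assoc (1 + count x Y) _ _) ⟩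
    1 + count x Y + count x X + ⟪ X , Y ⟫ ∎
    where open ≡-Reasoning

  ⟪X,X⟫-mono : ∀ x X → ⟪ X , X ⟫ ≤ ⟪ x ∷ X , x ∷ X ⟫
  ⟪X,X⟫-mono x X rewrite ⟪∷,∷⟫ x X X = m≤n+m _ _

  length≤⟪X,X⟫ : ∀ X → length X ≤ ⟪ X , X ⟫
  length≤⟪X,X⟫ [] = z≤n
  length≤⟪X,X⟫ (x ∷ X) rewrite ⟪∷,∷⟫ x X X = s≤s (≤-trans (length≤⟪X,X⟫ X) (m≤n+m _ _))

  -- pointwise this is 2ab ≤ a² + b² for the multiplicities a, b of each element
  2⟪X,Y⟫≤⟪X,X⟫+⟪Y,Y⟫ : ∀ X Y → 2 * ⟪ X , Y ⟫ ≤ ⟪ X , X ⟫ + ⟪ Y , Y ⟫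
  2⟪X,Y⟫≤⟪X,X⟫+⟪Y,Y⟫ [] Y = z≤n
  2⟪X,Y⟫≤⟪X,X⟫+⟪Y,Y⟫ (x ∷ X) Y with count x Y in eq
  ... | zero = begin
    2 * ⟪ X , Y ⟫                 ≤⟨ 2⟪X,Y⟫≤⟪X,X⟫+⟪Y,Y⟫ X Y ⟩
    ⟪ X , X ⟫ + ⟪ Y , Y ⟫         ≤⟨ +-monoˡ-≤ _ (⟪X,X⟫-mono x X) ⟩
    ⟪ x ∷ X , x ∷ X ⟫ + ⟪ Y , Y ⟫ ∎
    where open ≤-Reasoning
  ... | suc k with extract x Y (subst (1 ≤_) (sym eq) (s≤s z≤n))
  ...   | Y′ , Y≈x∷Y′ = begin
    2 * (suc k + ⟪ X , Y ⟫)                     ≡⟨ cong (λ t → 2 * (t + ⟪ X , Y ⟫)) (sym eq) ⟩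
    2 * ⟪ x ∷ X , Y ⟫                           ≡⟨ cong (2 *_) (⟪⟫-congʳ (x ∷ X) Y (x ∷ Y′) Y≈x∷Y′) ⟩
    2 * ⟪ x ∷ X , x ∷ Y′ ⟫                      ≡⟨ cong (2 *_) (⟪∷,∷⟫ x X Y′) ⟩
    2 * (1 + count x Y′ + count x X + ⟪ X , Y′ ⟫)
      ≤⟨ step (count x Y′) (count x X) ⟪ X , Y′ ⟫ ⟪ X , X ⟫ ⟪ Y′ , Y′ ⟫ (2⟪X,Y⟫≤⟪X,X⟫+⟪Y,Y⟫ X Y′) ⟩
    (1 + count x X + count x X + ⟪ X , X ⟫) + (1 + count x Y′ + count x Y′ + ⟪ Y′ , Y′ ⟫)
      ≡⟨ sym (cong₂ _+_ (⟪∷,∷⟫ x X X) (⟪∷,∷⟫ x Y′ Y′)) ⟩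
    ⟪ x ∷ X , x ∷ X ⟫ + ⟪ x ∷ Y′ , x ∷ Y′ ⟫
      ≡⟨ cong (⟪ x ∷ X , x ∷ X ⟫ +_) (sym (trans (⟪⟫-congʳ Y Y (x ∷ Y′) Y≈x∷Y′) (⟪⟫-congˡ Y (x ∷ Y′) (x ∷ Y′) Y≈x∷Y′))) ⟩
    ⟪ x ∷ X , x ∷ X ⟫ + ⟪ Y , Y ⟫ ∎
    where
      open ≤-Reasoning
      step : ∀ a b s p q → 2 * s ≤ p + q → 2 * (1 + a + b + s) ≤ (1 + b + b + p) + (1 + a + a + q)
      step a b s p q h = subst₂ _≤_ (lhs a b s) (rhs a b p q) (+-monoʳ-≤ (2 + 2 * a + 2 * b) h)
        where lhs : ∀ a b s → 2 + 2 * a + 2 * b + 2 * s ≡ 2 * (1 + a + b + s)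
              lhs = solve-∀
              rhs : ∀ a b p q → 2 + 2 * a + 2 * b + (p + q) ≡ (1 + b + b + p) + (1 + a + a + q)
              rhs = solve-∀

  -- Apply the previous inequality to s copies of X and p copies of Y, with s = ⟪ X , Y ⟫
  -- and p = ⟪ X , X ⟫: it reads 2 s² p ≤ s² p + p² q, and one divides by p.
  cauchy-schwarz : ∀ X Y → ⟪ X , Y ⟫ * ⟪ X , Y ⟫ ≤ ⟪ X , X ⟫ * ⟪ Y , Y ⟫
  cauchy-schwarz [] Y = z≤n
  cauchy-schwarz (x ∷ X) Y = *-cancelˡ-≤ p {{p≢0}} s²p≤p²q
    where
      s = ⟪ x ∷ X , Y ⟫
      p = ⟪ x ∷ X , x ∷ X ⟫
      q = ⟪ Y , Y ⟫
      p≢0 : NonZero p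
      p≢0 = >-nonZero (≤-trans (s≤s z≤n) (length≤⟪X,X⟫ (x ∷ X)))
      scaled : 2 * (s * (p * s)) ≤ s * (s * p) + p * (p * q)
      scaled = subst₂ _≤_ (cong (2 *_) (⟪⟫-copies s p (x ∷ X) Y))
                          (cong₂ _+_ (⟪⟫-copies s s (x ∷ X) (x ∷ X)) (⟪⟫-copies p p Y Y))
                          (2⟪X,Y⟫≤⟪X,X⟫+⟪Y,Y⟫ (copies s (x ∷ X)) (copies p Y))
      s²p≤p²q : p * (s * s) ≤ p * (p * q)
      s²p≤p²q = subst₂ _≤_ (*-comm (s * s) p) refl
        (+-cancelˡ-≤ (s * s * p) _ _ (subst₂ _≤_ (lhs s p) (rhs s p q) scaled))
        where lhs : ∀ s p → 2 * (s * (p * s)) ≡ s * s * p + s * s * p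
              lhs = solve-∀
              rhs : ∀ s p q → s * (s * p) + p * (p * q) ≡ s * s * p + p * (p * q)
              rhs = solve-∀

  -- Cauchy–Schwarz against B, where ⟪ X , B ⟫ = |X| and ⟪ B , B ⟫ = |B|
  pigeonhole : ∀ (P : A → Set) B → (∀ x → P x → count x B ≡ 1) → All P B →
               ∀ X → All P X → length X * length X ≤ ⟪ X , X ⟫ * length B
  pigeonhole P B once PB X PX = subst₂ _≤_ (cong₂ _*_ ⟪X,B⟫≡|X| ⟪X,B⟫≡|X|) (cong (⟪ X , X ⟫ *_) ⟪B,B⟫≡|B|)
                                       (cauchy-schwarz X B)
    where
      ⟪X,B⟫≡|X| : ⟪ X , B ⟫ ≡ length X
      ⟪X,B⟫≡|X| = trans (∑-congᴬ X PX once) (∑-1 X)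
      ⟪B,B⟫≡|B| : ⟪ B , B ⟫ ≡ length B
      ⟪B,B⟫≡|B| = trans (∑-congᴬ B PB once) (∑-1 B)

-- Integer vectors and boxes

infixl 6 _⊕_

_⊕_ : Vec ℤ n → Vec ℤ n → Vec ℤ n
_⊕_ = zipWith ℤ._+_

neg : Vec ℤ n → Vec ℤ n
neg = Vec.map (ℤ.-_)

𝟘 : (n : ℕ) → Vec ℤ n
𝟘 n = replicate n 0ℤ

⊕-comm : (x y : Vec ℤ n) → x ⊕ y ≡ y ⊕ x
⊕-comm [] [] = refl
⊕-comm (a ∷ x) (b ∷ y) = cong₂ _∷_ (ℤ.+-comm a b) (⊕-comm x y)

⊕-assoc : (x y z : Vec ℤ n) → (x ⊕ y) ⊕ z ≡ x ⊕ (y ⊕ z)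
⊕-assoc = Vec.zipWith-assoc ℤ.+-assoc

⊕-identityˡ : (x : Vec ℤ n) → 𝟘 n ⊕ x ≡ x
⊕-identityˡ = Vec.zipWith-identityˡ ℤ.+-identityˡ

⊕-identityʳ : (x : Vec ℤ n) → x ⊕ 𝟘 n ≡ x
⊕-identityʳ = Vec.zipWith-identityʳ ℤ.+-identityʳ

⊕-neg-⊕ : (x v : Vec ℤ n) → (x ⊕ neg v) ⊕ v ≡ x
⊕-neg-⊕ {n} x v = begin
  (x ⊕ neg v) ⊕ v ≡⟨ ⊕-assoc x (neg v) v ⟩
  x ⊕ (neg v ⊕ v) ≡⟨ cong (x ⊕_) (Vec.zipWith-inverseˡ ℤ.+-inverseˡ v) ⟩
  x ⊕ 𝟘 n         ≡⟨ ⊕-identityʳ x ⟩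
  x               ∎
  where open ≡-Reasoning

⊕-⊕-neg : (x v : Vec ℤ n) → (x ⊕ v) ⊕ neg v ≡ x
⊕-⊕-neg {n} x v = begin
  (x ⊕ v) ⊕ neg v ≡⟨ ⊕-assoc x v (neg v) ⟩
  x ⊕ (v ⊕ neg v) ≡⟨ cong (x ⊕_) (Vec.zipWith-inverseʳ ℤ.+-inverseʳ v) ⟩
  x ⊕ 𝟘 n         ≡⟨ ⊕-identityʳ x ⟩
  x               ∎
  where open ≡-Reasoning

⊕-cancelʳ : {x y : Vec ℤ n} (v : Vec ℤ n) → x ⊕ v ≡ y ⊕ v → x ≡ y
⊕-cancelʳ {x = x} {y} v e = trans (sym (⊕-⊕-neg x v)) (trans (cong (_⊕ neg v) e) (⊕-⊕-neg y v))

⊕-neg⇒≡⊕ : {x y : Vec ℤ n} (v : Vec ℤ n) → x ⊕ neg v ≡ y → x ≡ y ⊕ v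
⊕-neg⇒≡⊕ {x = x} v e = trans (sym (⊕-neg-⊕ x v)) (cong (_⊕ v) e)

≡⊕⇒⊕-neg : {x y : Vec ℤ n} (v : Vec ℤ n) → x ≡ y ⊕ v → x ⊕ neg v ≡ y
≡⊕⇒⊕-neg {y = y} v e = trans (cong (_⊕ neg v) e) (⊕-⊕-neg y v)

module ℤᶜ = Coincidences ℤ._≟_
open module Vecᶜ {n : ℕ} = Coincidences (Vec.≡-dec {n = n} ℤ._≟_)

δ-∷ : (y x : ℤ) (ys v : Vec ℤ n) → δ (y ∷ ys) (x ∷ v) ≡ ℤᶜ.δ y x * δ ys v
δ-∷ y x ys v = by-cases (y ℤ.≟ x) (Vec.≡-dec ℤ._≟_ ys v)
  where
    by-cases : Dec (y ≡ x) → Dec (ys ≡ v) → δ (y ∷ ys) (x ∷ v) ≡ ℤᶜ.δ y x * δ ys v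
    by-cases (yes y≡x) (yes ys≡v) = trans (δ-≡ (cong₂ _∷_ y≡x ys≡v)) (sym (cong₂ _*_ (ℤᶜ.δ-≡ y≡x) (δ-≡ ys≡v)))
    by-cases (yes y≡x) (no ys≢v) = trans (δ-≢ (λ e → ys≢v (Vec.∷-injectiveʳ e))) (sym (cong₂ _*_ (ℤᶜ.δ-≡ y≡x) (δ-≢ ys≢v)))
    by-cases (no y≢x) _ = trans (δ-≢ (λ e → y≢x (Vec.∷-injectiveˡ e))) (cong (_* δ ys v) (sym (ℤᶜ.δ-≢ y≢x)))

count-allVecs-∷ : (xs : List ℤ) (y : ℤ) (ys : Vec ℤ n) →
                  count (y ∷ ys) (allVecs xs (suc n)) ≡ ℤᶜ.count y xs * count ys (allVecs xs n)
count-allVecs-∷ {n} xs y ys = begin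
  count (y ∷ ys) (allVecs xs (suc n))
    ≡⟨ ∑-product _∷_ xs (allVecs xs n) _ ⟩
  ∑ xs (λ a → ∑ (allVecs xs n) (λ v → δ (y ∷ ys) (a ∷ v)))
    ≡⟨ ∑-cong xs (λ a → ∑-cong (allVecs xs n) (δ-∷ y a ys)) ⟩
  ∑ xs (λ a → ∑ (allVecs xs n) (λ v → ℤᶜ.δ y a * δ ys v))
    ≡⟨ ∑-cong xs (λ a → trans (*-distribˡ-∑ (allVecs xs n) (ℤᶜ.δ y a) _) (*-comm (ℤᶜ.δ y a) _)) ⟩
  ∑ xs (λ a → count ys (allVecs xs n) * ℤᶜ.δ y a)
    ≡⟨ trans (*-distribˡ-∑ xs (count ys (allVecs xs n)) (ℤᶜ.δ y)) (*-comm _ (ℤᶜ.count y xs)) ⟩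
  ℤᶜ.count y xs * count ys (allVecs xs n) ∎
  where open ≡-Reasoning

allVecs⁺ : {P : ℤ → Set} {xs : List ℤ} → All P xs → ∀ n → All (Allᵛ.All P {n}) (allVecs xs n)
allVecs⁺ Pxs zero = Allᵛ.[] ∷ []
allVecs⁺ {xs = xs} Pxs (suc n) =
  All.concat⁺ (All.map⁺ (All.map (λ Pa → All.map⁺ (All.map (Pa Allᵛ.∷_) (allVecs⁺ Pxs n))) Pxs))

length-allVecs : (xs : List ℤ) (n : ℕ) → length (allVecs xs n) ≡ length xs ^ n
length-allVecs xs zero = refl
length-allVecs xs (suc n) = begin
  length (allVecs xs (suc n))               ≡⟨ length-concatMap _ xs ⟩
  ∑ xs (λ a → length (map (a ∷_) (allVecs xs n)))
    ≡⟨ ∑-cong xs (λ a → trans (List.length-map (a ∷_) (allVecs xs n)) (length-allVecs xs n)) ⟩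
  ∑ xs (λ _ → length xs ^ n)                ≡⟨ ∑-const xs _ ⟩
  length xs * length xs ^ n                 ∎
  where open ≡-Reasoning

range : ℕ → List ℤ
range zero = 0ℤ ∷ []
range (suc r) = ℤ.+ suc r ∷ -[1+ r ] ∷ range r

length-range : ∀ r → length (range r) ≡ 2 * r + 1
length-range zero = refl
length-range (suc r) = trans (cong (λ t → suc (suc t)) (length-range r)) (2+[2r+1] r)
  where 2+[2r+1] : ∀ r → suc (suc (2 * r + 1)) ≡ 2 * suc r + 1
        2+[2r+1] = solve-∀

range-bounded : ∀ r → All (λ z → ∣ z ∣ ≤ r) (range r)
range-bounded zero = z≤n ∷ []
range-bounded (suc r) = ≤-refl ∷ ≤-refl ∷ All.map (λ h → m≤n⇒m≤1+n h) (range-bounded r)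

count-range-> : ∀ r z → r < ∣ z ∣ → ℤᶜ.count z (range r) ≡ 0
count-range-> r z r<∣z∣ = trans (∑-congᴬ (range r) (range-bounded r) (λ y ∣y∣≤r → ℤᶜ.δ-≢ (z≢y y ∣y∣≤r))) (∑-0 (range r))
  where z≢y : ∀ y → ∣ y ∣ ≤ r → z ≢ y
        z≢y y ∣y∣≤r refl = <⇒≱ r<∣z∣ ∣y∣≤r

count-range-≤ : ∀ r z → ∣ z ∣ ≤ r → ℤᶜ.count z (range r) ≡ 1
count-range-≤ zero z ∣z∣≤0 = cong (_+ 0) (ℤᶜ.δ-≡ (ℤ.∣i∣≡0⇒i≡0 (n≤0⇒n≡0 ∣z∣≤0)))
count-range-≤ (suc r) z ∣z∣≤1+r with m≤n⇒m<n∨m≡n ∣z∣≤1+r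
... | inj₁ (s≤s ∣z∣≤r) =
  cong₂ _+_ (ℤᶜ.δ-≢ {z} {ℤ.+ suc r} λ e → <-irrefl (cong ∣_∣ e) (s≤s ∣z∣≤r))
            (cong₂ _+_ (ℤᶜ.δ-≢ {z} { -[1+ r ]} λ e → <-irrefl (cong ∣_∣ e) (s≤s ∣z∣≤r)) (count-range-≤ r z ∣z∣≤r))
count-range-≤ (suc r) (ℤ.+ .(suc r)) _ | inj₂ refl =
  cong₂ _+_ (ℤᶜ.δ-refl (ℤ.+ suc r)) (cong₂ _+_ (ℤᶜ.δ-≢ {ℤ.+ suc r} { -[1+ r ]} λ ()) (count-range-> r (ℤ.+ suc r) ≤-refl))
count-range-≤ (suc r) -[1+ .r ] _ | inj₂ refl =
  cong₂ _+_ (ℤᶜ.δ-≢ { -[1+ r ]} {ℤ.+ suc r} λ ()) (cong₂ _+_ (ℤᶜ.δ-refl -[1+ r ]) (count-range-> r -[1+ r ] ≤-refl))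

Box : ℕ → Vec ℤ n → Set
Box r = Allᵛ.All (λ z → ∣ z ∣ ≤ r)

count-allVecs-range : ∀ r (x : Vec ℤ n) → Box r x → count x (allVecs (range r) n) ≡ 1
count-allVecs-range r [] Allᵛ.[] = cong (_+ 0) (δ-refl [])
count-allVecs-range r (y ∷ ys) (∣y∣≤r Allᵛ.∷ ys∈Box) =
  trans (count-allVecs-∷ (range r) y ys) (cong₂ _*_ (count-range-≤ r y ∣y∣≤r) (count-allVecs-range r ys ys∈Box))

box-pigeonhole : ∀ r n (X : List (Vec ℤ n)) → All (Box r) X → length X * length X ≤ ⟪ X , X ⟫ * (2 * r + 1) ^ n
box-pigeonhole r n X X⊆Box = subst (λ t → length X * length X ≤ ⟪ X , X ⟫ * t)
  (trans (length-allVecs (range r) n) (cong (_^ n) (length-range r)))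
  (pigeonhole (Box r) (allVecs (range r) n) (count-allVecs-range r) (allVecs⁺ (range-bounded r) n) X X⊆Box)

-- Exponential growth and log-convex sequences

^-distribʳ-* : ∀ a b n → (a * b) ^ n ≡ a ^ n * b ^ n
^-distribʳ-* a b zero = refl
^-distribʳ-* a b (suc n) rewrite ^-distribʳ-* a b n = interchange a b (a ^ n) (b ^ n)
  where interchange : ∀ a b x y → a * b * (x * y) ≡ a * x * (b * y)
        interchange = solve-∀

1+n≤2^n : ∀ n → suc n ≤ 2 ^ n
1+n≤2^n zero = s≤s z≤n
1+n≤2^n (suc n) = begin
  suc (suc n)   ≤⟨ s≤s (m≤n+m (suc n) n) ⟩
  suc n + suc n ≤⟨ +-mono-≤ (1+n≤2^n n) (1+n≤2^n n) ⟩
  2 ^ n + 2 ^ n ≡⟨ cong (2 ^ n +_) (sym (+-identityʳ _)) ⟩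
  2 ^ suc n     ∎
  where open ≤-Reasoning

-- t = A E^e (e + 1) with E = D (e + 1) + 3 works, since then D t + 3 ≤ E (u + 1) for u = A E^e
2^n-beats-polynomial : ∀ A D e → ∃ λ t → A * (D * t + 3) ^ e < 2 ^ t
2^n-beats-polynomial A D e = t , A[Dt+3]^e<2^t
  where
    E = D * suc e + 3
    u = A * E ^ e
    t = u * suc e
    Dt+3≤E[1+u] : D * t + 3 ≤ E * suc u
    Dt+3≤E[1+u] = begin
      D * (u * suc e) + 3                       ≤⟨ m≤m+n _ (D * suc e + 3 * u) ⟩
      D * (u * suc e) + 3 + (D * suc e + 3 * u) ≡⟨ expand D u e ⟩
      (D * suc e + 3) * suc u                   ∎
      where open ≤-Reasoning
            expand : ∀ D u e → D * (u * suc e) + 3 + (D * suc e + 3 * u) ≡ (D * suc e + 3) * suc u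
            expand = solve-∀
    A[Dt+3]^e<2^t : A * (D * t + 3) ^ e < 2 ^ t
    A[Dt+3]^e<2^t = begin-strict
      A * (D * t + 3) ^ e     ≤⟨ *-monoʳ-≤ A (^-monoˡ-≤ e Dt+3≤E[1+u]) ⟩
      A * (E * suc u) ^ e     ≡⟨ cong (A *_) (^-distribʳ-* E (suc u) e) ⟩
      A * (E ^ e * suc u ^ e) ≡⟨ sym (*-assoc A (E ^ e) _) ⟩
      u * suc u ^ e           <⟨ *-monoˡ-< (suc u ^ e) {{m^n≢0 (suc u) e}} (n<1+n u) ⟩
      suc u ^ suc e           ≤⟨ ^-monoˡ-≤ (suc e) (1+n≤2^n u) ⟩
      (2 ^ u) ^ suc e         ≡⟨ ^-*-assoc 2 u (suc e) ⟩
      2 ^ t                   ∎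
      where open ≤-Reasoning

-- Bernoulli's inequality (1 + 1/s)^n ≥ 1 + n/s, multiplied out
bernoulli : ∀ s n → s ^ n * (s + n) ≤ suc s ^ n * s
bernoulli s zero = ≤-reflexive (cong (_+ 0) (+-identityʳ s))
bernoulli s (suc n) = begin
  s * s ^ n * (s + suc n)   ≤⟨ grow ⟩
  suc s * (s ^ n * (s + n)) ≤⟨ *-monoʳ-≤ (suc s) (bernoulli s n) ⟩
  suc s * (suc s ^ n * s)   ≡⟨ sym (*-assoc (suc s) (suc s ^ n) s) ⟩
  suc s * suc s ^ n * s     ∎
  where
    open ≤-Reasoning
    grow : s * s ^ n * (s + suc n) ≤ suc s * (s ^ n * (s + n))
    grow = subst₂ _≤_ (sym (lhs s (s ^ n) n)) (sym (rhs s (s ^ n) n)) (m≤m+n _ _)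
      where lhs : ∀ s p n → s * p * (s + suc n) ≡ p * (s * s + s * n + s)
            lhs = solve-∀
            rhs : ∀ s p n → suc s * (p * (s + n)) ≡ p * (s * s + s * n + s) + p * n
            rhs = solve-∀

2[1+s]^[1+s]≤[2+s]^[1+s] : ∀ s → 2 * suc s ^ suc s ≤ suc (suc s) ^ suc s
2[1+s]^[1+s]≤[2+s]^[1+s] s =
  *-cancelʳ-≤ _ _ (suc s) (subst₂ _≤_ (regroup (suc s ^ suc s) s) refl (bernoulli (suc s) (suc s)))
  where regroup : ∀ p s → p * (suc s + suc s) ≡ 2 * p * suc s
        regroup = solve-∀

-- ((1 + s) / s)^K eventually exceeds any polynomial in K: K = (1 + s) t doubles the ratio t times
exponential-beats-polynomial : ∀ s A e → ∃ λ K → A * (2 * K + 3) ^ e * s ^ K < suc s ^ K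
exponential-beats-polynomial zero A e = 1 , subst (_< 1) (sym (*-zeroʳ (A * 5 ^ e))) (s≤s z≤n)
exponential-beats-polynomial (suc s) A e with 2^n-beats-polynomial A (2 * suc s) e
... | t , A[2[1+s]t+3]^e<2^t = K , bound
  where
    K = suc s * t
    bound : A * (2 * K + 3) ^ e * suc s ^ K < suc (suc s) ^ K
    bound = begin-strict
      A * (2 * K + 3) ^ e * suc s ^ K
        ≡⟨ cong (λ x → A * (x + 3) ^ e * suc s ^ K) (sym (*-assoc 2 (suc s) t)) ⟩
      A * (2 * suc s * t + 3) ^ e * suc s ^ K
        <⟨ *-monoˡ-< (suc s ^ K) {{m^n≢0 (suc s) K}} A[2[1+s]t+3]^e<2^t ⟩
      2 ^ t * suc s ^ K                   ≡⟨ cong (2 ^ t *_) (sym (^-*-assoc (suc s) (suc s) t)) ⟩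
      2 ^ t * (suc s ^ suc s) ^ t         ≡⟨ sym (^-distribʳ-* 2 _ t) ⟩
      (2 * suc s ^ suc s) ^ t             ≤⟨ ^-monoˡ-≤ t (2[1+s]^[1+s]≤[2+s]^[1+s] s) ⟩
      (suc (suc s) ^ suc s) ^ t           ≡⟨ ^-*-assoc (suc (suc s)) (suc s) t ⟩
      suc (suc s) ^ K                     ∎
      where open ≤-Reasoning

-- y n / x n ≥ q − 1 / M for all large n, for every M; stated without division
RatioEventually≥ : (x y : ℕ → ℕ) → ℕ → Set
RatioEventually≥ x y q = ∀ M → ∃ λ N → ∀ n → N ≤ n → M * q * x n ≤ M * y n + x n

LogConvex : (ℕ → ℕ) → Set
LogConvex z = ∀ k → z (suc k) * z (suc k) ≤ z k * z (suc (suc k))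

-- The ratios z (k + 1) / z k of a log-convex sequence increase. If they stayed below
-- q − 1/M = s/M up to K, then z K ≤ (s/M)^K z 0, which contradicts z K ≥ q^K / poly(K)
-- for the K given by exponential-beats-polynomial.
module _ (z : ℕ → ℕ) (q e : ℕ) (1≤q : 1 ≤ q) (log-convex : LogConvex z)
         (lower : ∀ k → q ^ k ≤ (2 * k + 3) ^ e * z k) where

  private
    z≢0 : ∀ k → NonZero (z k)
    z≢0 k = ≢-nonZero λ zk≡0 → <⇒≱ (m^n>0 q {{>-nonZero 1≤q}} k)
      (subst (q ^ k ≤_) (trans (cong ((2 * k + 3) ^ e *_) zk≡0) (*-zeroʳ ((2 * k + 3) ^ e))) (lower k))

    module _ (M : ℕ) where

      Above : ℕ → Set
      Above k = M * q * z k ≤ M * z (suc k) + z k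

      above-suc : ∀ j → Above j → Above (suc j)
      above-suc j h = *-cancelˡ-≤ (z j) {{z≢0 j}} (begin
        z j * (M * q * z (suc j))                        ≡⟨ e₁ (z j) M q (z (suc j)) ⟩
        (M * q * z j) * z (suc j)                        ≤⟨ *-monoˡ-≤ (z (suc j)) h ⟩
        (M * z (suc j) + z j) * z (suc j)                ≡⟨ e₂ M (z (suc j)) (z j) ⟩
        M * (z (suc j) * z (suc j)) + z j * z (suc j)    ≤⟨ +-monoˡ-≤ _ (*-monoʳ-≤ M (log-convex j)) ⟩
        M * (z j * z (suc (suc j))) + z j * z (suc j)    ≡⟨ e₃ M (z j) (z (suc (suc j))) (z (suc j)) ⟩
        z j * (M * z (suc (suc j)) + z (suc j))          ∎)
        where
          open ≤-Reasoning
          e₁ : ∀ a M q b → a * (M * q * b) ≡ M * q * a * b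
          e₁ = solve-∀
          e₂ : ∀ M b a → (M * b + a) * b ≡ M * (b * b) + a * b
          e₂ = solve-∀
          e₃ : ∀ M a c b → M * (a * c) + a * b ≡ a * (M * c + b)
          e₃ = solve-∀

      above-upward : ∀ N → Above N → ∀ k → N ≤ k → Above k
      above-upward N h k N≤k = subst Above (m∸n+n≡m N≤k) (go (k ∸ N))
        where go : ∀ d → Above (d + N)
              go zero = h
              go (suc d) = above-suc (d + N) (go d)

      search : ∀ K → (∃ λ j → Above j) ⊎ (∀ j → j < K → ¬ Above j)
      search zero = inj₂ (λ j ())
      search (suc K) with search K
      ... | inj₁ found = inj₁ found
      ... | inj₂ none with M * q * z K ≤? M * z (suc K) + z K
      ...   | yes h = inj₁ (K , h)
      ...   | no ¬h = inj₂ λ where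
                j (s≤s j≤K) → case m≤n⇒m<n∨m≡n j≤K of λ where
                  (inj₁ j<K) → none j j<K
                  (inj₂ refl) → ¬h
        where open import Function using (case_of_)

      module _ (s : ℕ) (Mq≡1+s : M * q ≡ suc s) (K : ℕ) (none : ∀ j → j < K → ¬ Above j) where

        decay : ∀ j → j ≤ K → M ^ j * z j ≤ s ^ j * z 0
        decay zero _ = ≤-refl
        decay (suc j) j<K = begin
          M * M ^ j * z (suc j)    ≡⟨ e₁ M (M ^ j) (z (suc j)) ⟩
          M ^ j * (M * z (suc j))  ≤⟨ *-monoʳ-≤ (M ^ j) below ⟩
          M ^ j * (s * z j)        ≡⟨ e₂ (M ^ j) s (z j) ⟩
          s * (M ^ j * z j)        ≤⟨ *-monoʳ-≤ s (decay j (<⇒≤ j<K)) ⟩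
          s * (s ^ j * z 0)        ≡⟨ sym (*-assoc s (s ^ j) (z 0)) ⟩
          s * s ^ j * z 0          ∎
          where
            open ≤-Reasoning
            e₁ : ∀ M a b → M * a * b ≡ a * (M * b)
            e₁ = solve-∀
            e₂ : ∀ a s b → a * (s * b) ≡ s * (a * b)
            e₂ = solve-∀
            below : M * z (suc j) ≤ s * z j
            below = <⇒≤ (+-cancelʳ-< (z j) (M * z (suc j)) (s * z j)
              (subst (M * z (suc j) + z j <_) (trans (cong (_* z j) Mq≡1+s) (+-comm (z j) (s * z j)))
                     (≰⇒> (none j j<K))))

        contradiction : ¬ (z 0 * (2 * K + 3) ^ e * s ^ K < suc s ^ K)
        contradiction h = <-irrefl refl (<-≤-trans h (begin
          suc s ^ K                         ≡⟨ cong (_^ K) (sym Mq≡1+s) ⟩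
          (M * q) ^ K                       ≡⟨ ^-distribʳ-* M q K ⟩
          M ^ K * q ^ K                     ≤⟨ *-monoʳ-≤ (M ^ K) (lower K) ⟩
          M ^ K * ((2 * K + 3) ^ e * z K)   ≡⟨ e₁ (M ^ K) ((2 * K + 3) ^ e) (z K) ⟩
          (2 * K + 3) ^ e * (M ^ K * z K)   ≤⟨ *-monoʳ-≤ ((2 * K + 3) ^ e) (decay K ≤-refl) ⟩
          (2 * K + 3) ^ e * (s ^ K * z 0)   ≡⟨ e₂ ((2 * K + 3) ^ e) (s ^ K) (z 0) ⟩
          z 0 * (2 * K + 3) ^ e * s ^ K     ∎))
          where
            open ≤-Reasoning
            e₁ : ∀ a b c → a * (b * c) ≡ b * (a * c)
            e₁ = solve-∀
            e₂ : ∀ a b c → a * (b * c) ≡ c * a * b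
            e₂ = solve-∀

  log-convex-ratio≥ : RatioEventually≥ z (λ k → z (suc k)) q
  log-convex-ratio≥ zero = 0 , λ k _ → z≤n
  log-convex-ratio≥ M@(suc M′) with predecessor (*-mono-≤ (s≤s (z≤n {M′})) 1≤q)
    where predecessor : ∀ {n} → 1 ≤ n → ∃ λ s → n ≡ suc s
          predecessor {suc s} _ = s , refl
  ... | s , Mq≡1+s with exponential-beats-polynomial s (z 0) e
  ...   | K , beats with search M K
  ...     | inj₁ (j , h) = j , above-upward M j h
  ...     | inj₂ none = ⊥-elim (contradiction M s Mq≡1+s K none beats)

-- Limits of ratios

-- | y n / x n − q | ≤ 1 / M for all large n, for every M; stated without division
RatioTendsTo : (x y : ℕ → ℕ) → ℕ → Set
RatioTendsTo x y q = ∀ M → ∃ λ N → ∀ n → N ≤ n → (M * q * x n ≤ M * y n + x n) × (M * y n ≤ M * q * x n + x n)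

ratio-tendsto : ∀ x q → RatioEventually≥ x (λ k → x (suc k)) q → (∀ k → x (suc k) ≤ q * x k) →
                RatioTendsTo x (λ k → x (suc k)) q
ratio-tendsto x q above below M with above M
... | N , h = N , λ k N≤k → h k N≤k ,
  ≤-trans (subst (M * x (suc k) ≤_) (sym (*-assoc M q (x k))) (*-monoʳ-≤ M (below k))) (m≤m+n _ _)

-- The bounds on b₁ / b₀ that follow from ratio bounds on a, d and w = a₁ + 2 b₀ + d₀
-- (the subscript is the index k or k + 1), when a₁ and d₀ are at most K b₀.
middle-upper : ∀ M q a₁ a₂ b₀ b₁ d₀ d₁ K →
  M * q * a₁ ≤ M * a₂ + a₁ → M * q * d₀ ≤ M * d₁ + d₀ →
  a₂ + 2 * b₁ + d₁ ≤ q * (a₁ + 2 * b₀ + d₀) →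
  a₁ ≤ K * b₀ → d₀ ≤ K * b₀ →
  M * b₁ ≤ M * q * b₀ + K * b₀
middle-upper M q a₁ a₂ b₀ b₁ d₀ d₁ K a↑ d↑ w↓ a₁≤Kb₀ d₀≤Kb₀ =
  *-cancelˡ-≤ 2 (+-cancelˡ-≤ X _ _ (begin
    X + 2 * (M * b₁)                                   ≡⟨ e₁ M a₂ b₁ d₁ ⟩
    M * (a₂ + 2 * b₁ + d₁)                             ≤⟨ *-monoʳ-≤ M w↓ ⟩
    M * (q * (a₁ + 2 * b₀ + d₀))                       ≡⟨ e₂ M q a₁ b₀ d₀ ⟩
    M * q * a₁ + 2 * (M * q * b₀) + M * q * d₀         ≤⟨ +-mono-≤ (+-monoˡ-≤ _ a↑) d↑ ⟩
    (M * a₂ + a₁) + 2 * (M * q * b₀) + (M * d₁ + d₀)   ≡⟨ e₃ M a₂ a₁ q b₀ d₁ d₀ ⟩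
    X + (2 * (M * q * b₀) + a₁ + d₀)                   ≤⟨ +-monoʳ-≤ X (+-mono-≤ (+-monoʳ-≤ (2 * (M * q * b₀)) a₁≤Kb₀) d₀≤Kb₀) ⟩
    X + (2 * (M * q * b₀) + K * b₀ + K * b₀)           ≡⟨ cong (X +_) (e₄ M q b₀ K) ⟩
    X + 2 * (M * q * b₀ + K * b₀)                      ∎))
  where
    open ≤-Reasoning
    X = M * a₂ + M * d₁
    e₁ : ∀ M a₂ b₁ d₁ → M * a₂ + M * d₁ + 2 * (M * b₁) ≡ M * (a₂ + 2 * b₁ + d₁)
    e₁ = solve-∀
    e₂ : ∀ M q a₁ b₀ d₀ → M * (q * (a₁ + 2 * b₀ + d₀)) ≡ M * q * a₁ + 2 * (M * q * b₀) + M * q * d₀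
    e₂ = solve-∀
    e₃ : ∀ M a₂ a₁ q b₀ d₁ d₀ → (M * a₂ + a₁) + 2 * (M * q * b₀) + (M * d₁ + d₀) ≡ M * a₂ + M * d₁ + (2 * (M * q * b₀) + a₁ + d₀)
    e₃ = solve-∀
    e₄ : ∀ M q b₀ K → 2 * (M * q * b₀) + K * b₀ + K * b₀ ≡ 2 * (M * q * b₀ + K * b₀)
    e₄ = solve-∀

middle-lower : ∀ M q a₁ a₂ b₀ b₁ d₀ d₁ K →
  M * q * (a₁ + 2 * b₀ + d₀) ≤ M * (a₂ + 2 * b₁ + d₁) + (a₁ + 2 * b₀ + d₀) →
  a₂ ≤ q * a₁ → d₁ ≤ q * d₀ →
  a₁ ≤ K * b₀ → d₀ ≤ K * b₀ →
  M * q * b₀ ≤ M * b₁ + suc K * b₀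
middle-lower M q a₁ a₂ b₀ b₁ d₀ d₁ K w↑ a↓ d↓ a₁≤Kb₀ d₀≤Kb₀ =
  *-cancelˡ-≤ 2 (+-cancelˡ-≤ Y _ _ (begin
    Y + 2 * (M * q * b₀)                                  ≡⟨ e₁ M q a₁ b₀ d₀ ⟩
    M * q * (a₁ + 2 * b₀ + d₀)                            ≤⟨ w↑ ⟩
    M * (a₂ + 2 * b₁ + d₁) + (a₁ + 2 * b₀ + d₀)           ≡⟨ e₂ M a₂ b₁ d₁ a₁ b₀ d₀ ⟩
    M * a₂ + M * d₁ + (2 * (M * b₁) + (a₁ + 2 * b₀ + d₀))
      ≤⟨ +-monoˡ-≤ _ (+-mono-≤ (*-monoʳ-≤ M a↓) (*-monoʳ-≤ M d↓)) ⟩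
    M * (q * a₁) + M * (q * d₀) + (2 * (M * b₁) + (a₁ + 2 * b₀ + d₀))
      ≤⟨ +-monoʳ-≤ (M * (q * a₁) + M * (q * d₀)) (+-monoʳ-≤ (2 * (M * b₁)) (+-mono-≤ (+-monoˡ-≤ (2 * b₀) a₁≤Kb₀) d₀≤Kb₀)) ⟩
    M * (q * a₁) + M * (q * d₀) + (2 * (M * b₁) + (K * b₀ + 2 * b₀ + K * b₀))
      ≡⟨ e₃ M q a₁ d₀ b₁ K b₀ ⟩
    Y + 2 * (M * b₁ + suc K * b₀)                         ∎))
  where
    open ≤-Reasoning
    Y = M * q * a₁ + M * q * d₀
    e₁ : ∀ M q a₁ b₀ d₀ → M * q * a₁ + M * q * d₀ + 2 * (M * q * b₀) ≡ M * q * (a₁ + 2 * b₀ + d₀)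
    e₁ = solve-∀
    e₂ : ∀ M a₂ b₁ d₁ a₁ b₀ d₀ → M * (a₂ + 2 * b₁ + d₁) + (a₁ + 2 * b₀ + d₀) ≡ M * a₂ + M * d₁ + (2 * (M * b₁) + (a₁ + 2 * b₀ + d₀))
    e₂ = solve-∀
    e₃ : ∀ M q a₁ d₀ b₁ K b₀ → M * (q * a₁) + M * (q * d₀) + (2 * (M * b₁) + (K * b₀ + 2 * b₀ + K * b₀)) ≡ M * q * a₁ + M * q * d₀ + 2 * (M * b₁ + suc K * b₀)
    e₃ = solve-∀

-- With M = (K + 1) E, the error terms K b₀ and (K + 1) b₀ become at most b₀ after dividing by K + 1.
module _ (A B D W : ℕ → ℕ) (q K : ℕ)
  (W≡ : ∀ k → W k ≡ A (suc k) + 2 * B k + D k)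
  (A↑ : RatioEventually≥ A (λ k → A (suc k)) q)
  (D↑ : RatioEventually≥ D (λ k → D (suc k)) q)
  (W↑ : RatioEventually≥ W (λ k → W (suc k)) q)
  (A↓ : ∀ k → A (suc k) ≤ q * A k)
  (D↓ : ∀ k → D (suc k) ≤ q * D k)
  (W↓ : ∀ k → W (suc k) ≤ q * W k)
  (A≤KB : ∀ k → A (suc k) ≤ K * B k)
  (D≤KB : ∀ k → D k ≤ K * B k) where

  middle-ratio-tendsto : RatioTendsTo B (λ k → B (suc k)) q
  middle-ratio-tendsto E with A↑ (suc K * E) | D↑ (suc K * E) | W↑ (suc K * E)
  ... | N₁ , a↑ | N₂ , d↑ | N₃ , w↑ = N₁ + N₂ + N₃ , bounds
    where
      M = suc K * E
      bounds : ∀ k → N₁ + N₂ + N₃ ≤ k → (E * q * B k ≤ E * B (suc k) + B k) × (E * B (suc k) ≤ E * q * B k + B k)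
      bounds k N≤k = lower , upper
        where
          N₁≤1+k : N₁ ≤ suc k
          N₁≤1+k = m≤n⇒m≤1+n (≤-trans (≤-trans (m≤m+n N₁ N₂) (m≤m+n (N₁ + N₂) N₃)) N≤k)
          N₂≤k : N₂ ≤ k
          N₂≤k = ≤-trans (≤-trans (m≤n+m N₂ N₁) (m≤m+n (N₁ + N₂) N₃)) N≤k
          N₃≤k : N₃ ≤ k
          N₃≤k = ≤-trans (m≤n+m N₃ (N₁ + N₂)) N≤k
          w↑′ = subst₂ (λ w₀ w₁ → M * q * w₀ ≤ M * w₁ + w₀) (W≡ k) (W≡ (suc k)) (w↑ k N₃≤k)
          w↓′ = subst₂ (λ w₀ w₁ → w₁ ≤ q * w₀) (W≡ k) (W≡ (suc k)) (W↓ k)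
          upper′ = middle-upper M q (A (suc k)) (A (suc (suc k))) (B k) (B (suc k)) (D k) (D (suc k)) K
                     (a↑ (suc k) N₁≤1+k) (d↑ k N₂≤k) w↓′ (A≤KB k) (D≤KB k)
          lower′ = middle-lower M q (A (suc k)) (A (suc (suc k))) (B k) (B (suc k)) (D k) (D (suc k)) K
                     w↑′ (A↓ (suc k)) (D↓ k) (A≤KB k) (D≤KB k)
          lower : E * q * B k ≤ E * B (suc k) + B k
          lower = *-cancelˡ-≤ (suc K) (subst₂ _≤_ (e₁ K E q (B k)) (e₂ K E (B (suc k)) (B k)) lower′)
            where e₁ : ∀ K E q b₀ → suc K * E * q * b₀ ≡ suc K * (E * q * b₀)
                  e₁ = solve-∀
                  e₂ : ∀ K E b₁ b₀ → suc K * E * b₁ + suc K * b₀ ≡ suc K * (E * b₁ + b₀)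
                  e₂ = solve-∀
          upper : E * B (suc k) ≤ E * q * B k + B k
          upper = *-cancelˡ-≤ (suc K) (begin
            suc K * (E * B (suc k))                ≡⟨ sym (*-assoc (suc K) E _) ⟩
            M * B (suc k)                          ≤⟨ upper′ ⟩
            M * q * B k + K * B k                  ≤⟨ +-monoʳ-≤ (M * q * B k) (*-monoˡ-≤ (B k) (n≤1+n K)) ⟩
            M * q * B k + suc K * B k              ≡⟨ e K E q (B k) ⟩
            suc K * (E * q * B k + B k)            ∎)
            where
              open ≤-Reasoning
              e : ∀ K E q b₀ → suc K * E * q * b₀ + suc K * b₀ ≡ suc K * (E * q * b₀ + b₀)
              e = solve-∀

even-or-odd : ∀ n → ∃ λ k → n ≡ k + k ⊎ n ≡ suc (k + k)
even-or-odd zero = 0 , inj₁ refl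
even-or-odd (suc n) with even-or-odd n
... | k , inj₁ n≡2k = k , inj₂ (cong suc n≡2k)
... | k , inj₂ n≡1+2k = suc k , inj₁ (trans (cong suc n≡1+2k) (cong suc (sym (+-suc k k))))

interleave-ratio : ∀ (x A B : ℕ → ℕ) q → (∀ k → x (k + k) ≡ A k) → (∀ k → x (suc (k + k)) ≡ B k) →
                   RatioTendsTo A (λ k → A (suc k)) q → RatioTendsTo B (λ k → B (suc k)) q →
                   RatioTendsTo x (λ n → x (n + 2)) q
interleave-ratio x A B q x-even x-odd A→q B→q M with A→q M | B→q M
... | Nᴬ , A-bounds | Nᴮ , B-bounds = 2 * (Nᴬ + Nᴮ) , λ n N≤n → bounds n N≤n (even-or-odd n)
  where
    Bounds : ℕ → ℕ → Set
    Bounds a b = (M * q * a ≤ M * b + a) × (M * b ≤ M * q * a + a)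
    half-≤ : ∀ {S} k n → 2 * S ≤ n → n ≤ suc (k + k) → S ≤ k
    half-≤ {S} k n 2S≤n n≤1+2k =
      ≤-pred (*-cancelˡ-< 2 S (suc k) (≤-trans (s≤s (≤-trans 2S≤n n≤1+2k)) (≤-reflexive (2+2k k))))
      where 2+2k : ∀ k → suc (suc (k + k)) ≡ 2 * suc k
            2+2k = solve-∀
    2+k+k : ∀ k → suc k + suc k ≡ k + k + 2
    2+k+k = solve-∀
    bounds : ∀ n → 2 * (Nᴬ + Nᴮ) ≤ n → (∃ λ k → n ≡ k + k ⊎ n ≡ suc (k + k)) → Bounds (x n) (x (n + 2))
    bounds n N≤n (k , inj₁ refl) =
      subst₂ Bounds (sym (x-even k)) (trans (sym (x-even (suc k))) (cong x (2+k+k k)))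
        (A-bounds k (≤-trans (m≤m+n Nᴬ Nᴮ) (half-≤ k n N≤n (n≤1+n n))))
    bounds n N≤n (k , inj₂ refl) =
      subst₂ Bounds (sym (x-odd k)) (trans (sym (x-odd (suc k))) (cong x (cong suc (2+k+k k))))
        (B-bounds k (≤-trans (m≤n+m Nᴮ Nᴬ) (half-≤ k n N≤n ≤-refl)))

-- Walks in ℤ^m

-- Multisets of walk endpoints are lists; S is the multiset of steps.
module Walk {m : ℕ} (S : List (Vec ℤ m)) where

  c : ℕ
  c = length S

  step : List (Vec ℤ m) → List (Vec ℤ m)
  step X = concatMap (λ x → map (x ⊕_) S) X

  steps : ℕ → List (Vec ℤ m) → List (Vec ℤ m)
  steps zero X = X
  steps (suc k) X = step (steps k X)

  ∑-step : ∀ X f → ∑ (step X) f ≡ ∑ X (λ x → ∑ S (λ v → f (x ⊕ v)))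
  ∑-step X f = ∑-product _⊕_ X S f

  steps-+ : ∀ a b X → steps (a + b) X ≡ steps a (steps b X)
  steps-+ zero b X = refl
  steps-+ (suc a) b X = cong step (steps-+ a b X)

  steps-step : ∀ k X → steps k (step X) ≡ step (steps k X)
  steps-step zero X = refl
  steps-step (suc k) X = cong step (steps-step k X)

  step-++ : ∀ X Y → step (X ++ Y) ≡ step X ++ step Y
  step-++ X Y = List.concatMap-++ _ X Y

  steps-++ : ∀ k X Y → steps k (X ++ Y) ≡ steps k X ++ steps k Y
  steps-++ zero X Y = refl
  steps-++ (suc k) X Y = trans (cong step (steps-++ k X Y)) (step-++ (steps k X) (steps k Y))

  steps-[] : ∀ k → steps k [] ≡ []
  steps-[] zero = refl
  steps-[] (suc k) = cong step (steps-[] k)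

  length-step : ∀ X → length (step X) ≡ length X * c
  length-step X = trans (length-concatMap _ X) (trans (∑-cong X (λ x → List.length-map (x ⊕_) S)) (∑-const X c))

  length-steps : ∀ Z k → length (steps k Z) ≡ length Z * c ^ k
  length-steps Z zero = sym (*-identityʳ _)
  length-steps Z (suc k) = trans (length-step (steps k Z)) (trans (cong (_* c) (length-steps Z k)) (regroup (length Z) c (c ^ k)))
    where regroup : ∀ a c p → a * p * c ≡ a * (c * p)
          regroup = solve-∀

  shift : Vec ℤ m → List (Vec ℤ m) → List (Vec ℤ m)
  shift v X = map (_⊕ v) X

  ⟪⟫-shift : ∀ v X Y → ⟪ shift v X , shift v Y ⟫ ≡ ⟪ X , Y ⟫
  ⟪⟫-shift v X Y = trans (∑-map X (_⊕ v) _) (∑-cong X (λ x → trans (∑-map Y (_⊕ v) _)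
    (∑-cong Y (λ y → δ-cong (⊕-cancelʳ v) (cong (_⊕ v))))))

  ⟪shift,shift⟫≤⟪X,X⟫ : ∀ v w X → ⟪ shift v X , shift w X ⟫ ≤ ⟪ X , X ⟫
  ⟪shift,shift⟫≤⟪X,X⟫ v w X = *-cancelˡ-≤ 2 (begin
    2 * ⟪ shift v X , shift w X ⟫               ≤⟨ 2⟪X,Y⟫≤⟪X,X⟫+⟪Y,Y⟫ (shift v X) (shift w X) ⟩
    ⟪ shift v X , shift v X ⟫ + ⟪ shift w X , shift w X ⟫ ≡⟨ cong₂ _+_ (⟪⟫-shift v X X) (⟪⟫-shift w X X) ⟩
    ⟪ X , X ⟫ + ⟪ X , X ⟫                       ≡⟨ cong (⟪ X , X ⟫ +_) (sym (+-identityʳ _)) ⟩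
    2 * ⟪ X , X ⟫                               ∎)
    where open ≤-Reasoning

  step-shift : ∀ v X → step (shift v X) ≡ shift v (step X)
  step-shift v [] = refl
  step-shift v (x ∷ X) = begin
    map ((x ⊕ v) ⊕_) S ++ step (shift v X)       ≡⟨ cong₂ _++_ (List.map-cong (⊕-swap x v) S) (step-shift v X) ⟩
    map (λ u → (x ⊕ u) ⊕ v) S ++ shift v (step X) ≡⟨ cong (_++ shift v (step X)) (List.map-∘ S) ⟩
    shift v (map (x ⊕_) S) ++ shift v (step X)    ≡⟨ sym (List.map-++ (_⊕ v) (map (x ⊕_) S) (step X)) ⟩
    shift v (step (x ∷ X))                        ∎
    where
      open ≡-Reasoning
      ⊕-swap : ∀ x v u → (x ⊕ v) ⊕ u ≡ (x ⊕ u) ⊕ v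
      ⊕-swap x v u = trans (⊕-assoc x v u) (trans (cong (x ⊕_) (⊕-comm v u)) (sym (⊕-assoc x u v)))

  steps-shift : ∀ k v X → steps k (shift v X) ≡ shift v (steps k X)
  steps-shift zero v X = refl
  steps-shift (suc k) v X = trans (cong step (steps-shift k v X)) (step-shift v (steps k X))

  ⟪step,⟫ : ∀ X Y → ⟪ step X , Y ⟫ ≡ ∑ S (λ v → ⟪ shift v X , Y ⟫)
  ⟪step,⟫ X Y = trans (∑-step X _) (trans (∑-swap X S (λ x v → count (x ⊕ v) Y))
    (∑-cong S (λ v → sym (∑-map X (_⊕ v) _))))

  ⟪step,step⟫≤ : ∀ X → ⟪ step X , step X ⟫ ≤ c * c * ⟪ X , X ⟫
  ⟪step,step⟫≤ X = begin
    ⟪ step X , step X ⟫                                   ≡⟨ ⟪step,⟫ X (step X) ⟩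
    ∑ S (λ v → ⟪ shift v X , step X ⟫)
      ≡⟨ ∑-cong S (λ v → trans (⟪⟫-sym (shift v X) (step X)) (⟪step,⟫ X (shift v X))) ⟩
    ∑ S (λ v → ∑ S (λ w → ⟪ shift w X , shift v X ⟫))
      ≤⟨ ∑-mono-≤ S (λ v → ∑-mono-≤ S (λ w → ⟪shift,shift⟫≤⟪X,X⟫ w v X)) ⟩
    ∑ S (λ v → ∑ S (λ w → ⟪ X , X ⟫))                     ≡⟨ ∑-cong S (λ v → ∑-const S _) ⟩
    ∑ S (λ v → c * ⟪ X , X ⟫)                             ≡⟨ ∑-const S _ ⟩
    c * (c * ⟪ X , X ⟫)                                   ≡⟨ sym (*-assoc c c _) ⟩
    c * c * ⟪ X , X ⟫                                     ∎
    where open ≤-Reasoning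

  collisions : List (Vec ℤ m) → ℕ → ℕ
  collisions Z k = ⟪ steps k Z , steps k Z ⟫

  collisions-suc≤ : ∀ Z k → collisions Z (suc k) ≤ c * c * collisions Z k
  collisions-suc≤ Z k = ⟪step,step⟫≤ (steps k Z)

  collisions-point : ∀ k t → collisions [ t ] k ≡ collisions [ 𝟘 m ] k
  collisions-point k t = begin
    collisions [ t ] k                                      ≡⟨ cong (λ u → collisions [ u ] k) (sym (⊕-identityˡ t)) ⟩
    collisions (shift t [ 𝟘 m ]) k                          ≡⟨ cong (λ Y → ⟪ Y , Y ⟫) (steps-shift k t [ 𝟘 m ]) ⟩
    ⟪ shift t (steps k [ 𝟘 m ]) , shift t (steps k [ 𝟘 m ]) ⟫ ≡⟨ ⟪⟫-shift t (steps k [ 𝟘 m ]) (steps k [ 𝟘 m ]) ⟩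
    collisions [ 𝟘 m ] k                                    ∎
    where open ≡-Reasoning

  ⟪steps,⟫-∑ : ∀ k T Y → ⟪ steps k T , Y ⟫ ≡ ∑ T (λ t → ⟪ steps k [ t ] , Y ⟫)
  ⟪steps,⟫-∑ k [] Y = cong (⟪_, Y ⟫) (steps-[] k)
  ⟪steps,⟫-∑ k (t ∷ T) Y = trans (cong (⟪_, Y ⟫) (steps-++ k [ t ] T))
    (trans (⟪⟫-++ˡ (steps k [ t ]) (steps k T) Y) (cong (⟪ steps k [ t ] , Y ⟫ +_) (⟪steps,⟫-∑ k T Y)))

  -- by 2⟪X,Y⟫ ≤ ⟪X,X⟫ + ⟪Y,Y⟫ every pair of starting points contributes at most collisions [ 𝟘 m ] k
  collisions≤ : ∀ k T → collisions T k ≤ length T * (length T * collisions [ 𝟘 m ] k)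
  collisions≤ k T = begin
    collisions T k                                      ≡⟨ ⟪steps,⟫-∑ k T (steps k T) ⟩
    ∑ T (λ t → ⟪ steps k [ t ] , steps k T ⟫)
      ≡⟨ ∑-cong T (λ t → trans (⟪⟫-sym (steps k [ t ]) (steps k T)) (⟪steps,⟫-∑ k T (steps k [ t ]))) ⟩
    ∑ T (λ t → ∑ T (λ t′ → ⟪ steps k [ t′ ] , steps k [ t ] ⟫))
      ≤⟨ ∑-mono-≤ T (λ t → ∑-mono-≤ T (λ t′ → pair≤ t′ t)) ⟩
    ∑ T (λ t → ∑ T (λ t′ → collisions [ 𝟘 m ] k))         ≡⟨ trans (∑-cong T (λ t → ∑-const T _)) (∑-const T _) ⟩
    length T * (length T * collisions [ 𝟘 m ] k)         ∎
    where
      open ≤-Reasoning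
      pair≤ : ∀ t t′ → ⟪ steps k [ t ] , steps k [ t′ ] ⟫ ≤ collisions [ 𝟘 m ] k
      pair≤ t t′ = *-cancelˡ-≤ 2 (begin
        2 * ⟪ steps k [ t ] , steps k [ t′ ] ⟫     ≤⟨ 2⟪X,Y⟫≤⟪X,X⟫+⟪Y,Y⟫ (steps k [ t ]) (steps k [ t′ ]) ⟩
        collisions [ t ] k + collisions [ t′ ] k   ≡⟨ cong₂ _+_ (collisions-point k t) (collisions-point k t′) ⟩
        collisions [ 𝟘 m ] k + collisions [ 𝟘 m ] k ≡⟨ cong (collisions [ 𝟘 m ] k +_) (sym (+-identityʳ _)) ⟩
        2 * collisions [ 𝟘 m ] k                    ∎)

  module _ (S⊆Box : All (Box 1) S) where

    ⊕-Box : ∀ r {n} (x v : Vec ℤ n) → Box r x → Box 1 v → Box (suc r) (x ⊕ v)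
    ⊕-Box r [] [] _ _ = Allᵛ.[]
    ⊕-Box r (a ∷ x) (b ∷ v) (∣a∣≤r Allᵛ.∷ x∈Box) (∣b∣≤1 Allᵛ.∷ v∈Box) =
      ≤-trans (ℤ.∣i+j∣≤∣i∣+∣j∣ a b) (subst (∣ a ∣ + ∣ b ∣ ≤_) (+-comm r 1) (+-mono-≤ ∣a∣≤r ∣b∣≤1))
      Allᵛ.∷ ⊕-Box r x v x∈Box v∈Box

    step-Box : ∀ r X → All (Box r) X → All (Box (suc r)) (step X)
    step-Box r X X⊆Box = All.concat⁺ (All.map⁺ (All.map (λ {x} x∈Box →
      All.map⁺ (All.map (λ {v} v∈Box → ⊕-Box r x v x∈Box v∈Box) S⊆Box)) X⊆Box))

    steps-Box : ∀ Z → All (Box 1) Z → ∀ k → All (Box (suc k)) (steps k Z)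
    steps-Box Z Z⊆Box zero = Z⊆Box
    steps-Box Z Z⊆Box (suc k) = step-Box (suc k) (steps k Z) (steps-Box Z Z⊆Box k)

    -- the c^k walks from each point of Z end in a box of side 2k+3
    collisions-lower : ∀ Z → 1 ≤ length Z → All (Box 1) Z → ∀ k → (c * c) ^ k ≤ (2 * k + 3) ^ m * collisions Z k
    collisions-lower Z 1≤|Z| Z⊆Box k = begin
      (c * c) ^ k                             ≡⟨ ^-distribʳ-* c c k ⟩
      c ^ k * c ^ k                           ≤⟨ *-mono-≤ (m≤n*m (c ^ k) (length Z)) (m≤n*m (c ^ k) (length Z)) ⟩
      (length Z * c ^ k) * (length Z * c ^ k) ≡⟨ sym (cong₂ _*_ (length-steps Z k) (length-steps Z k)) ⟩
      length (steps k Z) * length (steps k Z) ≤⟨ box-pigeonhole (suc k) m (steps k Z) (steps-Box Z Z⊆Box k) ⟩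
      collisions Z k * (2 * suc k + 1) ^ m    ≡⟨ cong (λ t → collisions Z k * t ^ m) (2[1+k]+1 k) ⟩
      collisions Z k * (2 * k + 3) ^ m        ≡⟨ *-comm (collisions Z k) _ ⟩
      (2 * k + 3) ^ m * collisions Z k        ∎
      where
        open ≤-Reasoning
        2[1+k]+1 : ∀ k → 2 * suc k + 1 ≡ 2 * k + 3
        2[1+k]+1 = solve-∀
        instance
          _ : NonZero (length Z)
          _ = >-nonZero 1≤|Z|

  module Symmetric (S-symmetric : ∀ (f : Vec ℤ m → ℕ) → ∑ S f ≡ ∑ S (λ v → f (neg v))) where

    step-adjoint : ∀ X Y → ⟪ step X , Y ⟫ ≡ ⟪ X , step Y ⟫
    step-adjoint X Y = begin
      ⟪ step X , Y ⟫                                              ≡⟨ ∑-step X _ ⟩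
      ∑ X (λ x → ∑ S (λ v → ∑ Y (λ y → δ (x ⊕ v) y)))             ≡⟨ ∑-cong X (λ x → ∑-swap S Y _) ⟩
      ∑ X (λ x → ∑ Y (λ y → ∑ S (λ v → δ (x ⊕ v) y)))             ≡⟨ ∑-cong X (λ x → ∑-cong Y (λ y → S-symmetric _)) ⟩
      ∑ X (λ x → ∑ Y (λ y → ∑ S (λ v → δ (x ⊕ neg v) y)))
        ≡⟨ ∑-cong X (λ x → ∑-cong Y (λ y → ∑-cong S (λ v → δ-cong (⊕-neg⇒≡⊕ v) (≡⊕⇒⊕-neg v)))) ⟩
      ∑ X (λ x → ∑ Y (λ y → ∑ S (λ v → δ x (y ⊕ v))))             ≡⟨ ∑-cong X (λ x → sym (∑-step Y (δ x))) ⟩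
      ⟪ X , step Y ⟫                                              ∎
      where open ≡-Reasoning

    steps-adjoint : ∀ k X Y → ⟪ steps k X , Y ⟫ ≡ ⟪ X , steps k Y ⟫
    steps-adjoint zero X Y = refl
    steps-adjoint (suc k) X Y =
      trans (step-adjoint (steps k X) Y) (trans (steps-adjoint k X (step Y)) (cong ⟪ X ,_⟫ (steps-step k Y)))

    collisions-log-convex : ∀ Z → LogConvex (collisions Z)
    collisions-log-convex Z k = subst (λ t → t * t ≤ collisions Z k * collisions Z (suc (suc k)))
      (sym (step-adjoint (steps k Z) (step (steps k Z))))
      (cauchy-schwarz (steps k Z) (step (step (steps k Z))))

    collisions-ratio≥ : All (Box 1) S → 1 ≤ c → ∀ Z → 1 ≤ length Z → All (Box 1) Z →
                        RatioEventually≥ (collisions Z) (λ k → collisions Z (suc k)) (c * c)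
    collisions-ratio≥ S⊆Box 1≤c Z 1≤|Z| Z⊆Box =
      log-convex-ratio≥ (collisions Z) (c * c) m (*-mono-≤ 1≤c 1≤c) (collisions-log-convex Z)
        (collisions-lower S⊆Box Z 1≤|Z| Z⊆Box)

-- Matrices as sequences of columns

Vec₀-unique : (v : Vec A 0) → v ≡ []
Vec₀-unique [] = refl

transpose-∷ : (r : Vec A n) (M : Vec (Vec A n) m) → transpose (r ∷ M) ≡ zipWith _∷_ r (transpose M)
transpose-∷ r M = sym (Vec.zipWith-is-⊛ _∷_ r (transpose M))

transpose-zipWith-∷ : (r : Vec A n) (N : Vec (Vec A m) n) → transpose (zipWith _∷_ r N) ≡ r ∷ transpose N
transpose-zipWith-∷ [] [] = refl
transpose-zipWith-∷ (x ∷ r) (row ∷ N) rewrite transpose-zipWith-∷ r N = refl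

transpose-involutive : (M : Vec (Vec A n) m) → transpose (transpose M) ≡ M
transpose-involutive [] = Vec₀-unique _
transpose-involutive (row ∷ M) =
  trans (cong transpose (transpose-∷ row M))
        (trans (transpose-zipWith-∷ row (transpose M)) (cong (row ∷_) (transpose-involutive M)))

∑-allVecs-zipWith-∷ : (s : List A) (m n : ℕ) (h : Vec (Vec A (suc m)) n → ℕ) →
  ∑ (allVecs (allVecs s (suc m)) n) h ≡ ∑ (allVecs s n) (λ r → ∑ (allVecs (allVecs s m) n) (λ N → h (zipWith _∷_ r N)))
∑-allVecs-zipWith-∷ s m zero h = cong (_+ 0) (sym (+-identityʳ (h [])))
∑-allVecs-zipWith-∷ s m (suc n) h = begin
  ∑ (allVecs (allVecs s (suc m)) (suc n)) h
    ≡⟨ ∑-product _∷_ (allVecs s (suc m)) (allVecs (allVecs s (suc m)) n) h ⟩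
  ∑ (allVecs s (suc m)) (λ col → ∑ (allVecs (allVecs s (suc m)) n) (λ N → h (col ∷ N)))
    ≡⟨ ∑-product _∷_ s (allVecs s m) _ ⟩
  ∑ s (λ x → ∑ (allVecs s m) (λ col → ∑ (allVecs (allVecs s (suc m)) n) (λ N → h ((x ∷ col) ∷ N))))
    ≡⟨ ∑-cong s (λ x → ∑-cong (allVecs s m) (λ col → ∑-allVecs-zipWith-∷ s m n (λ N → h ((x ∷ col) ∷ N)))) ⟩
  ∑ s (λ x → ∑ (allVecs s m) (λ col → ∑ (allVecs s n) (λ r → ∑ (allVecs (allVecs s m) n) (λ N → h ((x ∷ col) ∷ zipWith _∷_ r N)))))
    ≡⟨ ∑-cong s (λ x → ∑-swap (allVecs s m) (allVecs s n) _) ⟩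
  ∑ s (λ x → ∑ (allVecs s n) (λ r → ∑ (allVecs s m) (λ col → ∑ (allVecs (allVecs s m) n) (λ N → h ((x ∷ col) ∷ zipWith _∷_ r N)))))
    ≡⟨ ∑-cong s (λ x → ∑-cong (allVecs s n) (λ r → sym (∑-product _∷_ (allVecs s m) (allVecs (allVecs s m) n) _))) ⟩
  ∑ s (λ x → ∑ (allVecs s n) (λ r → ∑ (allVecs (allVecs s m) (suc n)) (λ N → h (zipWith _∷_ (x ∷ r) N))))
    ≡⟨ sym (∑-product _∷_ s (allVecs s n) _) ⟩
  ∑ (allVecs s (suc n)) (λ r → ∑ (allVecs (allVecs s m) (suc n)) (λ N → h (zipWith _∷_ r N))) ∎
  where open ≡-Reasoning

∑-allVecs-[] : (n : ℕ) (f : Vec (Vec A 0) n → ℕ) → ∑ (allVecs [ [] ] n) f ≡ f (replicate n [])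
∑-allVecs-[] zero f = +-identityʳ _
∑-allVecs-[] (suc n) f =
  trans (∑-product _∷_ [ [] ] (allVecs [ [] ] n) f) (trans (+-identityʳ _) (∑-allVecs-[] n (λ v → f ([] ∷ v))))

∑-transpose : (s : List A) (m n : ℕ) (g : Vec (Vec A n) m → ℕ) →
  ∑ (allVecs (allVecs s n) m) g ≡ ∑ (allVecs (allVecs s m) n) (λ N → g (transpose N))
∑-transpose s zero n g =
  trans (+-identityʳ _) (sym (trans (∑-allVecs-[] n (λ N → g (transpose N))) (cong g (Vec₀-unique _))))
∑-transpose s (suc m) n g = begin
  ∑ (allVecs (allVecs s n) (suc m)) g
    ≡⟨ ∑-product _∷_ (allVecs s n) (allVecs (allVecs s n) m) g ⟩
  ∑ (allVecs s n) (λ r → ∑ (allVecs (allVecs s n) m) (λ M → g (r ∷ M)))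
    ≡⟨ ∑-cong (allVecs s n) (λ r → ∑-transpose s m n (λ M → g (r ∷ M))) ⟩
  ∑ (allVecs s n) (λ r → ∑ (allVecs (allVecs s m) n) (λ N → g (r ∷ transpose N)))
    ≡⟨ ∑-cong (allVecs s n) (λ r → ∑-cong (allVecs (allVecs s m) n) (λ N → cong g (sym (transpose-zipWith-∷ r N)))) ⟩
  ∑ (allVecs s n) (λ r → ∑ (allVecs (allVecs s m) n) (λ N → g (transpose (zipWith _∷_ r N))))
    ≡⟨ sym (∑-allVecs-zipWith-∷ s m n (λ N → g (transpose N))) ⟩
  ∑ (allVecs (allVecs s (suc m)) n) (λ N → g (transpose N)) ∎
  where open ≡-Reasoning

∑-allVecs-filterᵇ : (xs : List A) (p : A → Bool) (n : ℕ) (f : Vec A n → ℕ) →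
  ∑ (allVecs xs n) (λ N → 𝟙 (allᵇ p N) * f N) ≡ ∑ (allVecs (filterᵇ p xs) n) f
∑-allVecs-filterᵇ xs p zero f = cong (_+ 0) (+-identityʳ _)
∑-allVecs-filterᵇ xs p (suc n) f = begin
  ∑ (allVecs xs (suc n)) (λ N → 𝟙 (allᵇ p N) * f N)
    ≡⟨ ∑-product _∷_ xs (allVecs xs n) _ ⟩
  ∑ xs (λ a → ∑ (allVecs xs n) (λ N → 𝟙 (p a ∧ allᵇ p N) * f (a ∷ N)))
    ≡⟨ ∑-cong xs (λ a → ∑-cong (allVecs xs n) (λ N →
         trans (cong (_* f (a ∷ N)) (𝟙-∧ (p a) (allᵇ p N))) (*-assoc (𝟙 (p a)) _ _))) ⟩
  ∑ xs (λ a → ∑ (allVecs xs n) (λ N → 𝟙 (p a) * (𝟙 (allᵇ p N) * f (a ∷ N))))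
    ≡⟨ ∑-cong xs (λ a → *-distribˡ-∑ (allVecs xs n) (𝟙 (p a)) _) ⟩
  ∑ xs (λ a → 𝟙 (p a) * ∑ (allVecs xs n) (λ N → 𝟙 (allᵇ p N) * f (a ∷ N)))
    ≡⟨ ∑-cong xs (λ a → cong (𝟙 (p a) *_) (∑-allVecs-filterᵇ xs p n (λ N → f (a ∷ N)))) ⟩
  ∑ xs (λ a → 𝟙 (p a) * ∑ (allVecs (filterᵇ p xs) n) (λ N → f (a ∷ N)))
    ≡⟨ sym (∑-filterᵇ p xs _) ⟩
  ∑ (filterᵇ p xs) (λ a → ∑ (allVecs (filterᵇ p xs) n) (λ N → f (a ∷ N)))
    ≡⟨ sym (∑-product _∷_ (filterᵇ p xs) (allVecs (filterᵇ p xs) n) f) ⟩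
  ∑ (allVecs (filterᵇ p xs) (suc n)) f ∎
  where open ≡-Reasoning

columns : (m : ℕ) → List (Vec Sign m)
columns m = filterᵇ smallSum (allVecs signs m)

toℤ : Vec Sign m → Vec ℤ m
toℤ = Vec.map val

column-steps : (m : ℕ) → List (Vec ℤ m)
column-steps m = map toℤ (columns m)

flip : Vec Sign m → Vec Sign m
flip = Vec.map Sign.opposite

val-opposite : ∀ s → val (Sign.opposite s) ≡ ℤ.- val s
val-opposite Sign.- = refl
val-opposite Sign.+ = refl

lineSum-flip : (v : Vec Sign m) → lineSum (flip v) ≡ ℤ.- lineSum v
lineSum-flip [] = refl
lineSum-flip (s ∷ v) = trans (cong₂ ℤ._+_ (val-opposite s) (lineSum-flip v)) (sym (ℤ.neg-distrib-+ (val s) (lineSum v)))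

smallSum-flip : (v : Vec Sign m) → smallSum (flip v) ≡ smallSum v
smallSum-flip v = cong (_≤ᵇ 1) (trans (cong ∣_∣ (lineSum-flip v)) (ℤ.∣-i∣≡∣i∣ (lineSum v)))

toℤ-flip : (v : Vec Sign m) → toℤ (flip v) ≡ neg (toℤ v)
toℤ-flip [] = refl
toℤ-flip (s ∷ v) = cong₂ _∷_ (val-opposite s) (toℤ-flip v)

∑-flip : ∀ m (F : Vec Sign m → ℕ) → ∑ (allVecs signs m) F ≡ ∑ (allVecs signs m) (λ v → F (flip v))
∑-flip zero F = refl
∑-flip (suc m) F = begin
  ∑ (allVecs signs (suc m)) F                                            ≡⟨ ∑-product _∷_ signs (allVecs signs m) F ⟩
  ∑ V (λ v → F (Sign.+ ∷ v)) + (∑ V (λ v → F (Sign.- ∷ v)) + 0)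
    ≡⟨ cong₂ (λ a b → a + (b + 0)) (∑-flip m _) (∑-flip m _) ⟩
  ∑ V (λ v → F (Sign.+ ∷ flip v)) + (∑ V (λ v → F (Sign.- ∷ flip v)) + 0) ≡⟨ swap (∑ V (λ v → F (Sign.+ ∷ flip v))) (∑ V (λ v → F (Sign.- ∷ flip v))) ⟩
  ∑ V (λ v → F (Sign.- ∷ flip v)) + (∑ V (λ v → F (Sign.+ ∷ flip v)) + 0) ≡⟨ sym (∑-product _∷_ signs V (λ v → F (flip v))) ⟩
  ∑ (allVecs signs (suc m)) (λ v → F (flip v))                           ∎
  where
    open ≡-Reasoning
    V = allVecs signs m
    swap : ∀ a b → a + (b + 0) ≡ b + (a + 0)
    swap a b rewrite +-identityʳ a | +-identityʳ b = +-comm a b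

column-steps-symmetric : ∀ m (f : Vec ℤ m → ℕ) → ∑ (column-steps m) f ≡ ∑ (column-steps m) (λ v → f (neg v))
column-steps-symmetric m f = begin
  ∑ (column-steps m) f                                                     ≡⟨ ∑-map (columns m) toℤ f ⟩
  ∑ (columns m) (λ v → f (toℤ v))                                          ≡⟨ ∑-filterᵇ smallSum (allVecs signs m) _ ⟩
  ∑ (allVecs signs m) (λ v → 𝟙 (smallSum v) * f (toℤ v))                  ≡⟨ ∑-flip m _ ⟩
  ∑ (allVecs signs m) (λ v → 𝟙 (smallSum (flip v)) * f (toℤ (flip v)))
    ≡⟨ ∑-cong (allVecs signs m) (λ v → cong₂ (λ a b → 𝟙 a * f b) (smallSum-flip v) (toℤ-flip v)) ⟩
  ∑ (allVecs signs m) (λ v → 𝟙 (smallSum v) * f (neg (toℤ v)))            ≡⟨ sym (∑-filterᵇ smallSum (allVecs signs m) _) ⟩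
  ∑ (columns m) (λ v → f (neg (toℤ v)))                                    ≡⟨ sym (∑-map (columns m) toℤ _) ⟩
  ∑ (column-steps m) (λ v → f (neg v))                                     ∎
  where open ≡-Reasoning

Unit : Vec ℤ m → Set
Unit = Allᵛ.All (λ u → ∣ u ∣ ≡ 1)

toℤ-Unit : (v : Vec Sign m) → Unit (toℤ v)
toℤ-Unit [] = Allᵛ.[]
toℤ-Unit (Sign.- ∷ v) = refl Allᵛ.∷ toℤ-Unit v
toℤ-Unit (Sign.+ ∷ v) = refl Allᵛ.∷ toℤ-Unit v

Unit⇒Box : {x : Vec ℤ m} → Unit x → Box 1 x
Unit⇒Box = Allᵛ.map (λ ∣u∣≡1 → ≤-reflexive ∣u∣≡1)

column-steps-Unit : ∀ m → All Unit (column-steps m)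
column-steps-Unit m = All.map⁺ (All.universal (λ v → toℤ-Unit v) (columns m))

columnSum : Vec (Vec Sign m) n → Vec ℤ m
columnSum [] = 𝟘 _
columnSum (col ∷ N) = toℤ col ⊕ columnSum N

lineSums-transpose : (N : Vec (Vec Sign m) n) → Vec.map lineSum (transpose N) ≡ columnSum N
lineSums-transpose {m} [] = Vec.map-replicate lineSum [] m
lineSums-transpose (col ∷ N) = begin
  Vec.map lineSum (transpose (col ∷ N))              ≡⟨ cong (Vec.map lineSum) (transpose-∷ col N) ⟩
  Vec.map lineSum (zipWith _∷_ col (transpose N))    ≡⟨ lineSums-zipWith-∷ col (transpose N) ⟩
  toℤ col ⊕ Vec.map lineSum (transpose N)           ≡⟨ cong (toℤ col ⊕_) (lineSums-transpose N) ⟩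
  columnSum (col ∷ N)                                ∎
  where
    open ≡-Reasoning
    lineSums-zipWith-∷ : ∀ {n k} (col : Vec Sign n) (T : Vec (Vec Sign k) n) →
                          Vec.map lineSum (zipWith _∷_ col T) ≡ toℤ col ⊕ Vec.map lineSum T
    lineSums-zipWith-∷ [] [] = refl
    lineSums-zipWith-∷ (s ∷ col) (r ∷ T) = cong (_ ∷_) (lineSums-zipWith-∷ col T)

module ColumnWalk (m : ℕ) where
  open Walk (column-steps m) public

  ∑-columnSum : ∀ n (g : Vec ℤ m → ℕ) → ∑ (allVecs (columns m) n) (λ N → g (columnSum N)) ≡ ∑ (steps n [ 𝟘 m ]) g
  ∑-columnSum zero g = refl
  ∑-columnSum (suc n) g = begin
    ∑ (allVecs (columns m) (suc n)) (λ N → g (columnSum N))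
      ≡⟨ ∑-product _∷_ (columns m) (allVecs (columns m) n) _ ⟩
    ∑ (columns m) (λ col → ∑ (allVecs (columns m) n) (λ N → g (toℤ col ⊕ columnSum N)))
      ≡⟨ ∑-swap (columns m) (allVecs (columns m) n) _ ⟩
    ∑ (allVecs (columns m) n) (λ N → ∑ (columns m) (λ col → g (toℤ col ⊕ columnSum N)))
      ≡⟨ ∑-columnSum n (λ y → ∑ (columns m) (λ col → g (toℤ col ⊕ y))) ⟩
    ∑ (steps n [ 𝟘 m ]) (λ y → ∑ (columns m) (λ col → g (toℤ col ⊕ y)))
      ≡⟨ ∑-cong (steps n [ 𝟘 m ]) (λ y → trans (∑-cong (columns m) (λ col → cong g (⊕-comm (toℤ col) y)))
                                                (sym (∑-map (columns m) toℤ (λ v → g (y ⊕ v))))) ⟩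
    ∑ (steps n [ 𝟘 m ]) (λ y → ∑ (column-steps m) (λ v → g (y ⊕ v)))
      ≡⟨ sym (∑-step (steps n [ 𝟘 m ]) g) ⟩
    ∑ (steps (suc n) [ 𝟘 m ]) g ∎
    where open ≡-Reasoning

𝟙-∣z∣≤1 : ∀ z → 𝟙 (∣ z ∣ ≤ᵇ 1) ≡ ℤᶜ.count z (range 1)
𝟙-∣z∣≤1 (ℤ.+ 0) = refl
𝟙-∣z∣≤1 (ℤ.+ 1) = refl
𝟙-∣z∣≤1 (ℤ.+ suc (suc n)) = refl
𝟙-∣z∣≤1 -[1+ 0 ] = refl
𝟙-∣z∣≤1 -[1+ suc n ] = refl

𝟙-allᵇ-∣z∣≤1 : (x : Vec ℤ n) → 𝟙 (allᵇ (λ z → ∣ z ∣ ≤ᵇ 1) x) ≡ count x (allVecs (range 1) n)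
𝟙-allᵇ-∣z∣≤1 [] = refl
𝟙-allᵇ-∣z∣≤1 (z ∷ x) = begin
  𝟙 ((∣ z ∣ ≤ᵇ 1) ∧ allᵇ (λ z → ∣ z ∣ ≤ᵇ 1) x)                 ≡⟨ 𝟙-∧ (∣ z ∣ ≤ᵇ 1) _ ⟩
  𝟙 (∣ z ∣ ≤ᵇ 1) * 𝟙 (allᵇ (λ z → ∣ z ∣ ≤ᵇ 1) x)             ≡⟨ cong₂ _*_ (𝟙-∣z∣≤1 z) (𝟙-allᵇ-∣z∣≤1 x) ⟩
  ℤᶜ.count z (range 1) * count x (allVecs (range 1) _)      ≡⟨ sym (count-allVecs-∷ (range 1) z x) ⟩
  count (z ∷ x) (allVecs (range 1) (suc _))                 ∎
  where open ≡-Reasoning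

allᵇ-map : {A B : Set} (p : B → Bool) (f : A → B) (v : Vec A n) → allᵇ (λ a → p (f a)) v ≡ allᵇ p (Vec.map f v)
allᵇ-map p f [] = refl
allᵇ-map p f (a ∷ v) = cong (p (f a) ∧_) (allᵇ-map p f v)

α-walks : ∀ m n → α m n ≡ ⟪ ColumnWalk.steps m n [ 𝟘 m ] , allVecs (range 1) m ⟫
α-walks m n = begin
  α m n                                                                  ≡⟨ length-filterᵇ inA (allMats m n) ⟩
  ∑ (allMats m n) (λ M → 𝟙 (inA M))                                       ≡⟨ ∑-transpose signs m n _ ⟩
  ∑ (allVecs (allVecs signs m) n) (λ N → 𝟙 (inA (transpose N)))
    ≡⟨ ∑-cong (allVecs (allVecs signs m) n) 𝟙-inA-transpose ⟩
  ∑ (allVecs (allVecs signs m) n) (λ N → 𝟙 (allᵇ smallSum N) * 𝟙 (allᵇ smallSum (transpose N)))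
    ≡⟨ ∑-allVecs-filterᵇ (allVecs signs m) smallSum n _ ⟩
  ∑ (allVecs (columns m) n) (λ N → 𝟙 (allᵇ smallSum (transpose N)))
    ≡⟨ ∑-cong (allVecs (columns m) n) 𝟙-rows-small ⟩
  ∑ (allVecs (columns m) n) (λ N → count (columnSum N) (allVecs (range 1) m))
    ≡⟨ ColumnWalk.∑-columnSum m n _ ⟩
  ⟪ ColumnWalk.steps m n [ 𝟘 m ] , allVecs (range 1) m ⟫                  ∎
  where
    open ≡-Reasoning
    𝟙-inA-transpose : ∀ N → 𝟙 (inA (transpose N)) ≡ 𝟙 (allᵇ smallSum N) * 𝟙 (allᵇ smallSum (transpose N))
    𝟙-inA-transpose N = begin
      𝟙 (allᵇ smallSum (transpose N) ∧ allᵇ smallSum (transpose (transpose N)))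
        ≡⟨ 𝟙-∧ (allᵇ smallSum (transpose N)) _ ⟩
      𝟙 (allᵇ smallSum (transpose N)) * 𝟙 (allᵇ smallSum (transpose (transpose N)))
        ≡⟨ *-comm (𝟙 (allᵇ smallSum (transpose N))) _ ⟩
      𝟙 (allᵇ smallSum (transpose (transpose N))) * 𝟙 (allᵇ smallSum (transpose N))
        ≡⟨ cong (λ M → 𝟙 (allᵇ smallSum M) * 𝟙 (allᵇ smallSum (transpose N))) (transpose-involutive N) ⟩
      𝟙 (allᵇ smallSum N) * 𝟙 (allᵇ smallSum (transpose N)) ∎
    𝟙-rows-small : ∀ N → 𝟙 (allᵇ smallSum (transpose N)) ≡ count (columnSum N) (allVecs (range 1) m)
    𝟙-rows-small N = begin
      𝟙 (allᵇ smallSum (transpose N))                                 ≡⟨ cong 𝟙 (allᵇ-map (λ z → ∣ z ∣ ≤ᵇ 1) lineSum (transpose N)) ⟩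
      𝟙 (allᵇ (λ z → ∣ z ∣ ≤ᵇ 1) (Vec.map lineSum (transpose N)))    ≡⟨ cong (λ x → 𝟙 (allᵇ (λ z → ∣ z ∣ ≤ᵇ 1) x)) (lineSums-transpose N) ⟩
      𝟙 (allᵇ (λ z → ∣ z ∣ ≤ᵇ 1) (columnSum N))                      ≡⟨ 𝟙-allᵇ-∣z∣≤1 (columnSum N) ⟩
      count (columnSum N) (allVecs (range 1) m)                        ∎

-- Parity, and α as collision counts

parity-suc : ∀ n → parity (suc n) ≡ parity n ⁻¹
parity-suc n = sym (ℙ.⁻¹-selfInverse (ℙ.suc-homo-⁻¹ n))

parity-+unit : ∀ z u → ∣ u ∣ ≡ 1 → parity ∣ z ℤ.+ u ∣ ≡ parity ∣ z ∣ ⁻¹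
parity-+unit (ℤ.+ n) (ℤ.+ 1) refl = trans (cong parity (+-comm n 1)) (parity-suc n)
parity-+unit -[1+ zero ] (ℤ.+ 1) refl = refl
parity-+unit -[1+ suc n ] (ℤ.+ 1) refl = parity-suc n
parity-+unit (ℤ.+ zero) -[1+ 0 ] refl = refl
parity-+unit (ℤ.+ suc n) -[1+ 0 ] refl = sym (ℙ.suc-homo-⁻¹ n)
parity-+unit -[1+ n ] -[1+ 0 ] refl = trans (cong (λ t → parity (suc (suc t))) (+-identityʳ n)) (sym (ℙ.suc-homo-⁻¹ n))

HasParity : Parity → Vec ℤ k → Set
HasParity p = Allᵛ.All (λ z → parity ∣ z ∣ ≡ p)

⊕-Unit-parity : ∀ {p} (x v : Vec ℤ k) → HasParity p x → Unit v → HasParity (p ⁻¹) (x ⊕ v)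
⊕-Unit-parity [] [] _ _ = Allᵛ.[]
⊕-Unit-parity (z ∷ x) (u ∷ v) (z-par Allᵛ.∷ x-par) (∣u∣≡1 Allᵛ.∷ v-unit) =
  trans (parity-+unit z u ∣u∣≡1) (cong _⁻¹ z-par) Allᵛ.∷ ⊕-Unit-parity x v x-par v-unit

count-allVecs-cong : {P : ℤ → Set} (xs ys : List ℤ) → (∀ z → P z → ℤᶜ.count z xs ≡ ℤᶜ.count z ys) →
                     (x : Vec ℤ k) → Allᵛ.All P x → count x (allVecs xs k) ≡ count x (allVecs ys k)
count-allVecs-cong xs ys same [] Allᵛ.[] = refl
count-allVecs-cong xs ys same (z ∷ x) (Pz Allᵛ.∷ Px) = begin
  count (z ∷ x) (allVecs xs _)                   ≡⟨ count-allVecs-∷ xs z x ⟩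
  ℤᶜ.count z xs * count x (allVecs xs _)         ≡⟨ cong₂ _*_ (same z Pz) (count-allVecs-cong xs ys same x Px) ⟩
  ℤᶜ.count z ys * count x (allVecs ys _)         ≡⟨ sym (count-allVecs-∷ ys z x) ⟩
  count (z ∷ x) (allVecs ys _)                   ∎
  where open ≡-Reasoning

units : List ℤ
units = ℤ.+ 1 ∷ -[1+ 0 ] ∷ []

count-range-1-even : ∀ z → parity ∣ z ∣ ≡ 0ℙ → ℤᶜ.count z (range 1) ≡ ℤᶜ.count z [ 0ℤ ]
count-range-1-even (ℤ.+ 0) _ = refl
count-range-1-even (ℤ.+ 1) ()
count-range-1-even (ℤ.+ suc (suc n)) _ = refl
count-range-1-even -[1+ 0 ] ()
count-range-1-even -[1+ suc n ] _ = refl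

count-range-1-odd : ∀ z → parity ∣ z ∣ ≡ 1ℙ → ℤᶜ.count z (range 1) ≡ ℤᶜ.count z units
count-range-1-odd (ℤ.+ 0) ()
count-range-1-odd (ℤ.+ 1) _ = refl
count-range-1-odd (ℤ.+ suc (suc n)) _ = refl
count-range-1-odd -[1+ 0 ] _ = refl
count-range-1-odd -[1+ suc n ] _ = refl

count-neg-units : ∀ u → ∣ u ∣ ≡ 1 → ℤᶜ.count (ℤ.- u) units ≡ 1
count-neg-units (ℤ.+ 1) refl = refl
count-neg-units -[1+ 0 ] refl = refl

count-neg-allVecs-units : (v : Vec ℤ k) → Unit v → count (neg v) (allVecs units k) ≡ 1
count-neg-allVecs-units [] Allᵛ.[] = refl
count-neg-allVecs-units (u ∷ v) (∣u∣≡1 Allᵛ.∷ v-unit) =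
  trans (count-allVecs-∷ units (ℤ.- u) (neg v)) (cong₂ _*_ (count-neg-units u ∣u∣≡1) (count-neg-allVecs-units v v-unit))

allVecs-[0] : ∀ k → allVecs [ 0ℤ ] k ≡ [ 𝟘 k ]
allVecs-[0] zero = refl
allVecs-[0] (suc k) rewrite allVecs-[0] k = refl

module ColumnSequences (m : ℕ) where
  open ColumnWalk m public
  open Symmetric (column-steps-symmetric m) public

  O : List (Vec ℤ m)
  O = [ 𝟘 m ]

  T : List (Vec ℤ m)
  T = allVecs units m

  a b d w : ℕ → ℕ
  a = collisions O
  b k = ⟪ steps k (step O) , steps k T ⟫
  d = collisions T
  w = collisions (step O ++ T)

  step-parity : ∀ p X → All (HasParity p) X → All (HasParity (p ⁻¹)) (step X)
  step-parity p X X-par = All.concat⁺ (All.map⁺ (All.map (λ {x} x-par →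
    All.map⁺ (All.map (λ {v} v-unit → ⊕-Unit-parity x v x-par v-unit) (column-steps-Unit m))) X-par))

  steps-parity : ∀ n → All (HasParity (parity n)) (steps n O)
  steps-parity zero = zero-even m ∷ []
    where zero-even : ∀ k → HasParity 0ℙ (𝟘 k)
          zero-even zero = Allᵛ.[]
          zero-even (suc k) = refl Allᵛ.∷ zero-even k
  steps-parity (suc n) = subst (λ p → All (HasParity p) (steps (suc n) O)) (sym (parity-suc n))
                               (step-parity (parity n) (steps n O) (steps-parity n))

  parity-k+k : ∀ k → parity (k + k) ≡ 0ℙ
  parity-k+k k = trans (ℙ.+-homo-+ k k) (ℙ.p+p≡0ℙ (parity k))

  α-even : ∀ k → α m (k + k) ≡ a k
  α-even k = begin
    α m (k + k)                                       ≡⟨ α-walks m (k + k) ⟩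
    ⟪ steps (k + k) O , allVecs (range 1) m ⟫
      ≡⟨ ∑-congᴬ (steps (k + k) O) even (count-allVecs-cong (range 1) [ 0ℤ ] count-range-1-even) ⟩
    ⟪ steps (k + k) O , allVecs [ 0ℤ ] m ⟫            ≡⟨ cong ⟪ steps (k + k) O ,_⟫ (allVecs-[0] m) ⟩
    ⟪ steps (k + k) O , O ⟫                           ≡⟨ cong ⟪_, O ⟫ (steps-+ k k O) ⟩
    ⟪ steps k (steps k O) , O ⟫                       ≡⟨ steps-adjoint k (steps k O) O ⟩
    a k                                               ∎
    where
      open ≡-Reasoning
      even : All (HasParity 0ℙ) (steps (k + k) O)
      even = subst (λ p → All (HasParity p) (steps (k + k) O)) (parity-k+k k) (steps-parity (k + k))

  α-odd : ∀ k → α m (suc (k + k)) ≡ b k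
  α-odd k = begin
    α m (suc (k + k))                                 ≡⟨ α-walks m (suc (k + k)) ⟩
    ⟪ steps (suc (k + k)) O , allVecs (range 1) m ⟫
      ≡⟨ ∑-congᴬ (steps (suc (k + k)) O) odd (count-allVecs-cong (range 1) units count-range-1-odd) ⟩
    ⟪ steps (suc (k + k)) O , T ⟫                     ≡⟨ cong (λ n → ⟪ steps n O , T ⟫) (sym (+-suc k k)) ⟩
    ⟪ steps (k + suc k) O , T ⟫                       ≡⟨ cong ⟪_, T ⟫ (steps-+ k (suc k) O) ⟩
    ⟪ steps k (step (steps k O)) , T ⟫                ≡⟨ steps-adjoint k (step (steps k O)) T ⟩
    ⟪ step (steps k O) , steps k T ⟫                  ≡⟨ cong ⟪_, steps k T ⟫ (sym (steps-step k O)) ⟩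
    b k                                               ∎
    where
      open ≡-Reasoning
      odd : All (HasParity 1ℙ) (steps (suc (k + k)) O)
      odd = subst (λ p → All (HasParity p) (steps (suc (k + k)) O))
                  (trans (parity-suc (k + k)) (cong _⁻¹ (parity-k+k k))) (steps-parity (suc (k + k)))

  w≡ : ∀ k → w k ≡ a (suc k) + 2 * b k + d k
  w≡ k = begin
    w k                                                    ≡⟨ cong (λ Y → ⟪ Y , Y ⟫) (steps-++ k (step O) T) ⟩
    ⟪ steps k (step O) ++ steps k T , steps k (step O) ++ steps k T ⟫ ≡⟨ ⟪++,++⟫ (steps k (step O)) (steps k T) ⟩
    collisions (step O) k + 2 * b k + d k                  ≡⟨ cong (λ t → t + 2 * b k + d k) (cong (λ Y → ⟪ Y , Y ⟫) (steps-step k O)) ⟩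
    a (suc k) + 2 * b k + d k                              ∎
    where open ≡-Reasoning

  -- each step v is undone by the point -v of T
  count-𝟘-step-T : count (𝟘 m) (step T) ≡ c
  count-𝟘-step-T = begin
    count (𝟘 m) (step T)                                  ≡⟨ ∑-step T (δ (𝟘 m)) ⟩
    ∑ T (λ t → ∑ (column-steps m) (λ v → δ (𝟘 m) (t ⊕ v))) ≡⟨ ∑-swap T (column-steps m) _ ⟩
    ∑ (column-steps m) (λ v → ∑ T (λ t → δ (𝟘 m) (t ⊕ v)))
      ≡⟨ ∑-cong (column-steps m) (λ v → ∑-cong T (λ t → δ-cong (to t v) (from t v))) ⟩
    ∑ (column-steps m) (λ v → count (neg v) T)
      ≡⟨ ∑-congᴬ (column-steps m) (column-steps-Unit m) count-neg-allVecs-units ⟩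
    ∑ (column-steps m) (λ _ → 1)                          ≡⟨ ∑-1 (column-steps m) ⟩
    c                                                     ∎
    where
      open ≡-Reasoning
      to : ∀ t v → 𝟘 m ≡ t ⊕ v → neg v ≡ t
      to t v e = trans (sym (⊕-identityˡ (neg v))) (≡⊕⇒⊕-neg v e)
      from : ∀ t v → neg v ≡ t → 𝟘 m ≡ t ⊕ v
      from t v e = trans (sym (⊕-neg-⊕ (𝟘 m) v)) (cong (_⊕ v) (trans (⊕-identityˡ (neg v)) e))

  c*count-O≤count-step-T : ∀ x → c * count x O ≤ count x (step T)
  c*count-O≤count-step-T x with x ≟ᵛ 𝟘 m
    where _≟ᵛ_ = Vec.≡-dec ℤ._≟_
  ... | yes refl = ≤-reflexive (trans (*-identityʳ c) (sym count-𝟘-step-T))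
  ... | no _ = subst (_≤ count x (step T)) (sym (*-zeroʳ c)) z≤n

  c*a≤b : ∀ k → c * a k ≤ b k
  c*a≤b k = begin
    c * a k                            ≡⟨ cong (c *_) (sym (steps-adjoint k (steps k O) O)) ⟩
    c * ⟪ steps k (steps k O) , O ⟫    ≡⟨ sym (*-distribˡ-∑ (steps k (steps k O)) c _) ⟩
    ∑ (steps k (steps k O)) (λ x → c * count x O)
      ≤⟨ ∑-mono-≤ (steps k (steps k O)) c*count-O≤count-step-T ⟩
    ⟪ steps k (steps k O) , step T ⟫   ≡⟨ steps-adjoint k (steps k O) (step T) ⟩
    ⟪ steps k O , steps k (step T) ⟫   ≡⟨ cong ⟪ steps k O ,_⟫ (steps-step k T) ⟩
    ⟪ steps k O , step (steps k T) ⟫   ≡⟨ sym (step-adjoint (steps k O) (steps k T)) ⟩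
    ⟪ step (steps k O) , steps k T ⟫   ≡⟨ cong ⟪_, steps k T ⟫ (sym (steps-step k O)) ⟩
    b k                                ∎
    where open ≤-Reasoning

  column-steps⊆Box : All (Box 1) (column-steps m)
  column-steps⊆Box = All.map Unit⇒Box (column-steps-Unit m)

  𝟘∈Box : ∀ r k → Box r (𝟘 k)
  𝟘∈Box r zero = Allᵛ.[]
  𝟘∈Box r (suc k) = z≤n Allᵛ.∷ 𝟘∈Box r k

  step-O⊆Box : All (Box 1) (step O)
  step-O⊆Box = step-Box column-steps⊆Box 0 O (𝟘∈Box 0 m ∷ [])

  α-1 : α m 1 ≡ c
  α-1 = begin
    α m 1                                    ≡⟨ α-walks m 1 ⟩
    ⟪ step O , allVecs (range 1) m ⟫         ≡⟨ ∑-congᴬ (step O) step-O⊆Box (count-allVecs-range 1) ⟩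
    ∑ (step O) (λ _ → 1)                     ≡⟨ ∑-1 (step O) ⟩
    length (step O)                          ≡⟨ length-step O ⟩
    1 * c                                    ≡⟨ *-identityˡ c ⟩
    c                                        ∎
    where open ≡-Reasoning

  module _ (1≤c : 1 ≤ c) where

    q : ℕ
    q = c * c

    K : ℕ
    K = c + length T * length T

    a≤b : ∀ k → a k ≤ b k
    a≤b k = ≤-trans (subst (_≤ c * a k) (*-identityˡ (a k)) (*-monoˡ-≤ (a k) 1≤c)) (c*a≤b k)

    a-suc≤K*b : ∀ k → a (suc k) ≤ K * b k
    a-suc≤K*b k = begin
      a (suc k)      ≤⟨ collisions-suc≤ O k ⟩
      c * c * a k    ≡⟨ *-assoc c c (a k) ⟩
      c * (c * a k)  ≤⟨ *-monoʳ-≤ c (c*a≤b k) ⟩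
      c * b k        ≤⟨ *-monoˡ-≤ (b k) (m≤m+n c _) ⟩
      K * b k        ∎
      where open ≤-Reasoning

    d≤K*b : ∀ k → d k ≤ K * b k
    d≤K*b k = begin
      d k                                 ≤⟨ collisions≤ k T ⟩
      length T * (length T * a k)         ≡⟨ sym (*-assoc (length T) (length T) (a k)) ⟩
      length T * length T * a k           ≤⟨ *-monoʳ-≤ (length T * length T) (a≤b k) ⟩
      length T * length T * b k           ≤⟨ *-monoˡ-≤ (b k) (m≤n+m _ c) ⟩
      K * b k                             ∎
      where open ≤-Reasoning

    a-positive : ∀ k → 1 ≤ a k
    a-positive k = begin
      1                        ≤⟨ m^n>0 c {{>-nonZero 1≤c}} k ⟩
      c ^ k                    ≡⟨ sym (*-identityˡ (c ^ k)) ⟩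
      length O * c ^ k         ≡⟨ sym (length-steps O k) ⟩
      length (steps k O)       ≤⟨ length≤⟪X,X⟫ (steps k O) ⟩
      a k                      ∎
      where open ≤-Reasoning

    α-positive : ∀ n → 1 ≤ α m n
    α-positive n with even-or-odd n
    ... | k , inj₁ refl = subst (1 ≤_) (sym (α-even k)) (a-positive k)
    ... | k , inj₂ refl = subst (1 ≤_) (sym (α-odd k)) (≤-trans (a-positive k) (a≤b k))

    T⊆Box : All (Box 1) T
    T⊆Box = allVecs⁺ (≤-refl ∷ ≤-refl ∷ []) m

    1≤|T| : 1 ≤ length T
    1≤|T| = subst (1 ≤_) (sym (length-allVecs units m)) (m^n>0 2 m)

    ratio≥ : ∀ Z → 1 ≤ length Z → All (Box 1) Z → RatioEventually≥ (collisions Z) (λ k → collisions Z (suc k)) q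
    ratio≥ = collisions-ratio≥ column-steps⊆Box 1≤c

    α-ratio : RatioTendsTo (α m) (λ n → α m (n + 2)) q
    α-ratio = interleave-ratio (α m) a b q α-even α-odd
      (ratio-tendsto a q (ratio≥ O (s≤s z≤n) (𝟘∈Box 1 m ∷ [])) (collisions-suc≤ O))
      (middle-ratio-tendsto a b d w q K w≡
        (ratio≥ O (s≤s z≤n) (𝟘∈Box 1 m ∷ []))
        (ratio≥ T 1≤|T| T⊆Box)
        (ratio≥ (step O ++ T) (≤-trans 1≤|T| (subst (length T ≤_) (sym (List.length-++ (step O))) (m≤n+m _ _)))
                              (All.++⁺ step-O⊆Box T⊆Box))
        (collisions-suc≤ O) (collisions-suc≤ T) (collisions-suc≤ (step O ++ T))
        a-suc≤K*b d≤K*b)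

-- Counting columns

minuses : Vec Sign k → ℕ
minuses [] = 0
minuses (Sign.+ ∷ v) = minuses v
minuses (Sign.- ∷ v) = suc (minuses v)

lineSum-minuses : (v : Vec Sign k) → lineSum v ≡ k ⊖ (minuses v + minuses v)
lineSum-minuses [] = refl
lineSum-minuses {suc k} (Sign.+ ∷ v) = trans (cong (ℤ._+_ (ℤ.+ 1)) (lineSum-minuses v)) (ℤ.distribʳ-⊖-+-pos 1 k (minuses v + minuses v))
lineSum-minuses {suc k} (Sign.- ∷ v) = begin
  -[1+ 0 ] ℤ.+ lineSum v             ≡⟨ cong (ℤ._+_ -[1+ 0 ]) (lineSum-minuses v) ⟩
  -[1+ 0 ] ℤ.+ (k ⊖ (j + j))         ≡⟨ ℤ.distribʳ-⊖-+-neg 0 k (j + j) ⟩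
  k ⊖ suc (j + j)                    ≡⟨ cong (k ⊖_) (sym (+-suc j j)) ⟩
  k ⊖ (j + suc j)                    ≡⟨ sym (ℤ.[1+m]⊖[1+n]≡m⊖n k (j + suc j)) ⟩
  suc k ⊖ (suc j + suc j)            ∎
  where open ≡-Reasoning
        j = minuses v

count-minuses : ∀ k j → ∑ (allVecs signs k) (λ v → 𝟙 (minuses v ≡ᵇ j)) ≡ k C j
count-minuses zero zero = refl
count-minuses zero (suc j) = refl
count-minuses (suc k) zero = trans (∑-product _∷_ signs (allVecs signs k) _)
  (cong₂ _+_ (count-minuses k zero) (trans (+-identityʳ _) (∑-0 (allVecs signs k))))
count-minuses (suc k) (suc j) = trans (∑-product _∷_ signs (allVecs signs k) _)
  (trans (cong₂ _+_ (count-minuses k (suc j)) (trans (+-identityʳ _) (count-minuses k j)))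
         (trans (+-comm (k C suc j) (k C j)) (nCk+nC[k+1]≡[n+1]C[k+1] k j)))

[c+2a+2]⊖[2b+2] : ∀ a b c → (c + suc a + suc a) ⊖ (suc b + suc b) ≡ (c + a + a) ⊖ (b + b)
[c+2a+2]⊖[2b+2] a b c = trans (cong (_⊖ (suc b + suc b)) (regroup c a))
  (trans (ℤ.[1+m]⊖[1+n]≡m⊖n (suc (c + a + a)) (b + suc b))
  (trans (cong (suc (c + a + a) ⊖_) (+-suc b b)) (ℤ.[1+m]⊖[1+n]≡m⊖n (c + a + a) (b + b))))
  where regroup : ∀ c a → c + suc a + suc a ≡ suc (suc (c + a + a))
        regroup = solve-∀

small-even : ∀ h j → 𝟙 (∣ (h + h) ⊖ (j + j) ∣ ≤ᵇ 1) ≡ 𝟙 (j ≡ᵇ h)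
small-even zero zero = refl
small-even zero (suc j) rewrite +-suc j j = refl
small-even (suc h) zero rewrite +-suc h h = refl
small-even (suc h) (suc j) = trans (cong (λ t → 𝟙 (∣ t ∣ ≤ᵇ 1)) ([c+2a+2]⊖[2b+2] h j 0)) (small-even h j)

small-odd : ∀ h j → 𝟙 (∣ suc (h + h) ⊖ (j + j) ∣ ≤ᵇ 1) ≡ 𝟙 (j ≡ᵇ h) + 𝟙 (j ≡ᵇ suc h)
small-odd zero zero = refl
small-odd zero (suc zero) = refl
small-odd zero (suc (suc j)) rewrite +-suc j (suc j) = refl
small-odd (suc h) zero = refl
small-odd (suc h) (suc j) = trans (cong (λ t → 𝟙 (∣ t ∣ ≤ᵇ 1)) ([c+2a+2]⊖[2b+2] h j 1)) (small-odd h j)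

length-columns : ∀ k → length (columns k) ≡ ∑ (allVecs signs k) (λ v → 𝟙 (∣ k ⊖ (minuses v + minuses v) ∣ ≤ᵇ 1))
length-columns k = trans (length-filterᵇ smallSum (allVecs signs k))
  (∑-cong (allVecs signs k) (λ v → cong (λ t → 𝟙 (∣ t ∣ ≤ᵇ 1)) (lineSum-minuses v)))

length-columns-even : ∀ h → length (columns (h + h)) ≡ (h + h) C h
length-columns-even h = trans (length-columns (h + h))
  (trans (∑-cong (allVecs signs (h + h)) (λ v → small-even h (minuses v))) (count-minuses (h + h) h))

length-columns-odd : ∀ h → length (columns (suc (h + h))) ≡ suc (suc (h + h)) C suc h
length-columns-odd h = begin
  length (columns (suc (h + h)))
    ≡⟨ length-columns (suc (h + h)) ⟩
  ∑ (allVecs signs (suc (h + h))) (λ v → 𝟙 (∣ suc (h + h) ⊖ (minuses v + minuses v) ∣ ≤ᵇ 1))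
    ≡⟨ ∑-cong (allVecs signs (suc (h + h))) (λ v → small-odd h (minuses v)) ⟩
  ∑ (allVecs signs (suc (h + h))) (λ v → 𝟙 (minuses v ≡ᵇ h) + 𝟙 (minuses v ≡ᵇ suc h))
    ≡⟨ ∑-distrib-+ (allVecs signs (suc (h + h))) _ _ ⟩
  ∑ (allVecs signs (suc (h + h))) (λ v → 𝟙 (minuses v ≡ᵇ h)) + ∑ (allVecs signs (suc (h + h))) (λ v → 𝟙 (minuses v ≡ᵇ suc h))
    ≡⟨ cong₂ _+_ (count-minuses (suc (h + h)) h) (count-minuses (suc (h + h)) (suc h)) ⟩
  suc (h + h) C h + suc (h + h) C suc h
    ≡⟨ nCk+nC[k+1]≡[n+1]C[k+1] (suc (h + h)) h ⟩
  suc (suc (h + h)) C suc h ∎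
  where open ≡-Reasoning

[2h+1]/2≡h : ∀ h → (h + h + 1) / 2 ≡ h
[2h+1]/2≡h zero = refl
[2h+1]/2≡h (suc h) = begin
  (suc h + suc h + 1) / 2           ≡⟨ /-congˡ {o = 2} (regroup h) ⟩
  suc (suc (h + h + 1)) / 2         ≡⟨ m/n≡1+[m∸n]/n {suc (suc (h + h + 1))} {2} (s≤s (s≤s z≤n)) ⟩
  suc ((h + h + 1) / 2)             ≡⟨ cong suc ([2h+1]/2≡h h) ⟩
  suc h                             ∎
  where open ≡-Reasoning
        regroup : ∀ h → suc h + suc h + 1 ≡ suc (suc (h + h + 1))
        regroup = solve-∀

[2h+2]/2≡1+h : ∀ h → (suc (h + h) + 1) / 2 ≡ suc h
[2h+2]/2≡1+h h = trans (/-congˡ {o = 2} (regroup h)) (m*n/n≡m (suc h) 2)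
  where regroup : ∀ h → suc (h + h) + 1 ≡ suc h * 2
        regroup = solve-∀

length-columns≡binomial : ∀ m → length (columns m) ≡ (2 * ((m + 1) / 2)) C ((m + 1) / 2)
length-columns≡binomial m with even-or-odd m
... | h , inj₁ refl rewrite [2h+1]/2≡h h = trans (length-columns-even h) (cong (_C h) (h+h≡2h h))
  where h+h≡2h : ∀ h → h + h ≡ 2 * h
        h+h≡2h = solve-∀
... | h , inj₂ refl rewrite [2h+2]/2≡1+h h = trans (length-columns-odd h) (cong (_C suc h) (2+h+h≡2[1+h] h))
  where 2+h+h≡2[1+h] : ∀ h → suc (suc (h + h)) ≡ 2 * suc h
        2+h+h≡2[1+h] = solve-∀

binomial-positive : ∀ n k → k ≤ n → 1 ≤ n C k
binomial-positive n zero _ = ≤-refl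
binomial-positive (suc n) (suc k) (s≤s k≤n) =
  subst (1 ≤_) (nCk+nC[k+1]≡[n+1]C[k+1] n k) (≤-trans (binomial-positive n k k≤n) (m≤m+n _ _))

-- The limit in ℚ

open import Data.Integer using (+_)

E*∣b-qa∣≤a : ∀ E a b q → E * q * a ≤ E * b + a → E * b ≤ E * q * a + a →
             E * ℤ.∣ b ⊖ q * a ∣ ≤ a
E*∣b-qa∣≤a E a b q lower upper with ≤-<-connex (q * a) b
... | inj₁ qa≤b = subst (λ t → E * t ≤ a) (sym (cong ℤ.∣_∣ (ℤ.⊖-≥ qa≤b)))
  (subst (_≤ a) (sym (*-distribˡ-∸ E b (q * a)))
    (m≤n+o⇒m∸n≤o (E * b) (E * (q * a)) (subst (λ t → E * b ≤ t + a) (*-assoc E q a) upper)))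
... | inj₂ b<qa = subst (λ t → E * t ≤ a) (sym (ℤ.∣⊖∣-< b<qa))
  (subst (_≤ a) (sym (*-distribˡ-∸ E (q * a) b))
    (m≤n+o⇒m∸n≤o (E * (q * a)) (E * b) (subst (λ t → t ≤ E * b + a) (*-assoc E q a) lower)))

-- |b / a − q| ≤ 1 / (d + 1) < p / d, where ε = p / d
∣b/a-q∣<ε : ∀ a b q .{{_ : NonZero a}} (ε : ℚ) → 0ℚ ℚ.< ε →
            suc (ℚ.↧ₙ ε) * ℤ.∣ b ⊖ q * a ∣ ≤ a → ℚ.∣ (+ b ℚ./ a) ℚ.- (+ q ℚ./ 1) ∣ ℚ.< ε
∣b/a-q∣<ε (suc a) b q (mkℚ (+ zero) d _) (ℚ.*<* (ℤ.+<+ ()))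
∣b/a-q∣<ε (suc a) b q (mkℚ -[1+ p ] d _) (ℚ.*<* ())
∣b/a-q∣<ε (suc a) b q (mkℚ (+ suc p) d _) _ close =
  ℚ.toℚᵘ-cancel-< (ℚᵘ.<-respˡ-≃ (ℚᵘ.≃-sym toℚᵘ-distance) (ℚᵘ.*<* cross-multiplied))
  where
    dist = ℤ.∣ b ⊖ q * suc a ∣
    x = + b ℚ./ suc a
    y = + q ℚ./ 1
    toℚᵘ-/ : ∀ i n .{{_ : NonZero n}} → toℚᵘ (i ℚ./ n) ℚᵘ.≃ (i ℚᵘ./ n)
    toℚᵘ-/ i (suc n) = ℚ.toℚᵘ-fromℚᵘ (mkℚᵘ i n)
    toℚᵘ-distance : toℚᵘ (ℚ.∣ (+ b ℚ./ suc a) ℚ.- (+ q ℚ./ 1) ∣) ℚᵘ.≃ ℚᵘ.∣ (+ b ℚᵘ./ suc a) ℚᵘ.- (+ q ℚᵘ./ 1) ∣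
    toℚᵘ-distance = ℚᵘ.≃-trans (ℚ.toℚᵘ-homo-∣-∣ (x ℚ.- y)) (ℚᵘ.∣-∣-cong (ℚᵘ.≃-trans (ℚ.toℚᵘ-homo-+ x (ℚ.- y))
      (ℚᵘ.+-cong (toℚᵘ-/ (+ b) (suc a)) (ℚᵘ.≃-trans (ℚ.toℚᵘ-homo‿- y) (ℚᵘ.-‿cong (toℚᵘ-/ (+ q) 1))))))
    numerator : + b ℤ.* + 1 ℤ.+ ℤ.- (+ q) ℤ.* + suc a ≡ b ⊖ q * suc a
    numerator = begin
      + b ℤ.* + 1 ℤ.+ ℤ.- (+ q) ℤ.* + suc a ≡⟨ cong₂ ℤ._+_ (ℤ.*-identityʳ (+ b)) (sym (ℤ.neg-distribˡ-* (+ q) (+ suc a))) ⟩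
      + b ℤ.+ ℤ.- (+ q ℤ.* + suc a)         ≡⟨ cong (λ t → + b ℤ.+ ℤ.- t) (sym (ℤ.pos-* q (suc a))) ⟩
      + b ℤ.+ ℤ.- (+ (q * suc a))           ≡⟨ ℤ.m-n≡m⊖n b (q * suc a) ⟩
      b ⊖ q * suc a                         ∎
      where open ≡-Reasoning
    lhs : + (dist * suc d) ≡ + ℤ.∣ + b ℤ.* + 1 ℤ.+ ℤ.- (+ q) ℤ.* + suc a ∣ ℤ.* + suc d
    lhs = trans (ℤ.pos-* dist (suc d)) (cong (λ t → + ℤ.∣ t ∣ ℤ.* + suc d) (sym numerator))
    cross< : ∀ δ → suc (suc d) * δ ≤ suc a → δ * suc d < suc p * (suc a * 1)
    cross< zero _ = *-mono-≤ {1} {suc p} {1} {suc a * 1} (s≤s z≤n) (s≤s z≤n)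
    cross< (suc δ) [d+2][δ+1]≤a+1 = begin-strict
      suc δ * suc d       ≤⟨ m≤m+n (suc δ * suc d) δ ⟩
      suc δ * suc d + δ   <⟨ ≤-trans (≤-reflexive (regroup δ d)) [d+2][δ+1]≤a+1 ⟩
      suc a               ≤⟨ m≤n*m (suc a) (suc p) ⟩
      suc p * suc a       ≡⟨ cong (suc p *_) (sym (*-identityʳ (suc a))) ⟩
      suc p * (suc a * 1) ∎
      where
        open ≤-Reasoning
        regroup : ∀ δ d → suc (suc δ * suc d + δ) ≡ suc (suc d) * suc δ
        regroup = solve-∀
    cross-multiplied : + ℤ.∣ + b ℤ.* + 1 ℤ.+ ℤ.- (+ q) ℤ.* + suc a ∣ ℤ.* + suc d ℤ.< + suc p ℤ.* + (suc a * 1)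
    cross-multiplied = subst₂ ℤ._<_ lhs (ℤ.pos-* (suc p) (suc a * 1)) (ℤ.+<+ (cross< dist close))

theorem4 : (m : ℕ) → 1 ≤ m →
    (α m 1 ^ 2 ≡ ((2 * ((m + 1) / 2)) C ((m + 1) / 2)) ^ 2)
    × Σ ((n : ℕ) → NonZero (α m (suc n))) (λ nz →
        (ε : ℚ) → 0ℚ ℚ.< ε → ∃ λ N → (n : ℕ) → N ≤ n →
          ℚ.∣ ℚ._-_ (ℚ._/_ (+ α m (suc n + 2)) (α m (suc n)) {{nz n}}) (ℚ._/_ (+ (α m 1 ^ 2)) 1) ∣ ℚ.< ε)
theorem4 m _ = cong (_^ 2) α-1≡binomial , α-nonzero , λ ε 0<ε →
  let N , bounds = ratio (suc (ℚ.↧ₙ ε)) in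
  N , λ n N≤n → let lower , upper = bounds (suc n) (m≤n⇒m≤1+n N≤n) in
    ∣b/a-q∣<ε (α m (suc n)) (α m (suc n + 2)) (α m 1 ^ 2) {{α-nonzero n}} ε 0<ε
      (E*∣b-qa∣≤a (suc (ℚ.↧ₙ ε)) (α m (suc n)) (α m (suc n + 2)) (α m 1 ^ 2) lower upper)
  where
    open ColumnSequences m
    α-1≡binomial : α m 1 ≡ (2 * ((m + 1) / 2)) C ((m + 1) / 2)
    α-1≡binomial = trans α-1 (trans (List.length-map toℤ (columns m)) (length-columns≡binomial m))
    1≤c : 1 ≤ c
    1≤c = subst (1 ≤_) (trans (sym α-1≡binomial) α-1) (binomial-positive (2 * h) h (m≤m+n h (h + 0)))
      where h = (m + 1) / 2
    α-nonzero : (n : ℕ) → NonZero (α m (suc n))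
    α-nonzero n = >-nonZero (α-positive 1≤c (suc n))
    ratio : RatioTendsTo (α m) (λ n → α m (n + 2)) (α m 1 ^ 2)
    ratio = subst (RatioTendsTo (α m) (λ n → α m (n + 2)))
                  (trans (cong (c *_) (sym (*-identityʳ c))) (cong (λ x → x * (x * 1)) (sym α-1)))
                  (α-ratio 1≤c)
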